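{- Let $r\ge 2$, $n\ge 2r$, and let $H\subseteq\binom{\Omega_n}{r}$ be $M_1^{(r)}$-saturated. Then: (1) for all $v_i$, $\rho(v_{i+1})=\lambda(v_i)$; (2) for all distinct $v_i,v_j$, $|[\rho(v_i),\lambda(v_i)]\cap[\rho(v_j),\lambda(v_j)]|\le 1$; (3) for all $j$, exactly one interval of the form $[\rho(v_i),\lambda(v_i)]$ contains both $v_j$ and $v_{j+1}$; (4) if $\lambda(v_i)\neq\rho(v_i)$, then $\lambda(\rho(v_i))=v_i$ and $\rho(\rho(v_i))\in[\lambda(v_i),v_i)$.
   Context: $\Omega_n=\{v_0,\dots,v_{n-1}\}$ carries the cyclic (clockwise) order $v_0<\dots<v_{n-1}<v_0$; indices of $v$ are modulo $n$. For $a,b\in\Omega_n$, $(a,b)$ is the set of points strictly between $a$ and $b$ travelling clockwise from $a$ to $b$, $[a,b]=(a,b)\cup\{a,b\}$ and $[a,b)=(a,b)\cup\{a\}$. Two $r$-sets $h_1,h_2$ form a copy of $M_1^{(r)}$ if they are disjoint and there are $a,b$ with $h_1\subseteq[a,b]$, $h_2\subseteq(b,a)$. $H$ is $M_1^{(r)}$-saturated if no two edges of $H$ form a copy of $M_1^{(r)}$ and every $e\in\binom{\Omega_n}{r}\setminus H$ forms a copy with some edge of $H$. (In this situation every vertex lies in an edge of $H$.) For $v_i$, $\lambda(v_i)$ is the unique $v_j$ such that some $h\in H$ has $v_i\in h\subseteq[v_j,v_i]$ but no $h\in H$ has $v_i\in h\subseteq[v_{j+1},v_i]$; $\rho(v_i)$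 is the unique $v_j$ such that some $h\in H$ has $v_i\in h\subseteq[v_i,v_j]$ but no $h\in H$ has $v_i\in h\subseteq[v_i,v_{j-1}]$. -}

module Defs where

open import Data.Nat using (ℕ; zero; suc; _+_; _∸_; _≤ᵇ_; _<ᵇ_; _%_)
open import Data.Nat.DivMod using (m%n<n)
open import Data.Fin using (Fin; toℕ; fromℕ<)
open import Data.Fin.Subset using (Subset; _∈_; _⊆_; _∩_; ∣_∣; Empty)
open import Data.Vec using (tabulate)
open import Data.Bool using (Bool; _∧_)
open import Data.Product using (Σ; ∃; _×_)
open import Data.Sum using (_⊎_)
open import Relation.Nullary using (¬_)
open import Relation.Binary.PropositionalEquality using (_≡_)

-- Ω_n = Fin n, v_i = i, cyclic order 0 < 1 < … < n-1 < 0.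

dist : ∀ {n} → Fin n → Fin n → ℕ
dist {suc m} a x = (toℕ x + suc m ∸ toℕ a) % suc m

next : ∀ {n} → Fin n → Fin n
next {suc m} i = fromℕ< (m%n<n (suc (toℕ i)) (suc m))

prev : ∀ {n} → Fin n → Fin n
prev {suc m} i = fromℕ< (m%n<n (toℕ i + m) (suc m))

-- cyclic intervals as subsets of Ω_n
-- [a,b] : points reached from a travelling clockwise up to b (so [a,a] = {a})
cc : ∀ {n} → Fin n → Fin n → Subset n
cc a b = tabulate (λ x → dist a x ≤ᵇ dist a b)

oo : ∀ {n} → Fin n → Fin n → Subset n
oo a b = tabulate (λ x → (0 <ᵇ dist a x) ∧ (dist a x <ᵇ dist a b))

co : ∀ {n} → Fin n → Fin n → Subset n
co a b = tabulate (λ x → dist a x <ᵇ dist a b)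

Hypergraph : ℕ → Set₁
Hypergraph n = Subset n → Set

CopyOrdered : ∀ {n} → Subset n → Subset n → Set
CopyOrdered h₁ h₂ = Empty (h₁ ∩ h₂) × ∃ λ a → ∃ λ b → (h₁ ⊆ cc a b) × (h₂ ⊆ oo b a)

FormCopy : ∀ {n} → Subset n → Subset n → Set
FormCopy h₁ h₂ = CopyOrdered h₁ h₂ ⊎ CopyOrdered h₂ h₁

Saturated : ∀ {n} → ℕ → Hypergraph n → Set
Saturated {n} r H =
  (∀ h₁ h₂ → H h₁ → H h₂ → ¬ FormCopy h₁ h₂) ×
  (∀ (e : Subset n) → ∣ e ∣ ≡ r → ¬ H e → ∃ λ h → H h × FormCopy e h)

EdgeIn : ∀ {n} → Hypergraph n → Fin n → Subset n → Set
EdgeIn H v I = ∃ λ h → H h × v ∈ h × h ⊆ I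

IsLambda : ∀ {n} → Hypergraph n → Fin n → Fin n → Set
IsLambda H i j = EdgeIn H i (cc j i) × ¬ EdgeIn H i (cc (next j) i)

IsRho : ∀ {n} → Hypergraph n → Fin n → Fin n → Set
IsRho H i j = EdgeIn H i (cc i j) × ¬ EdgeIn H i (cc i (prev j))

-- Positions on the circle are handled through the clockwise distance δ a x < n, in terms of which
-- arcs [a, b] become intervals of distances from a base point.  The combinatorial engine is an
-- exchange step: replacing a vertex a of an edge e by a vertex outside e gives either an edge or,
-- by saturation, an edge lying in an arc that avoids the new set but contains a.  Exchanges show
-- that every vertex lies in an edge (so λ and ρ exist), that ρ(v + 1) = λ(v), and that λ moves
-- forward: λ(i) ∈ [λ(i - 1), i), with λ(ρ(i)) = i and ρ(ρ(i)) ∈ [λ(i), i) when λ(i) ≠ ρ(i).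
-- The intervals [ρ(i), λ(i)] = [λ(i - 1), λ(i)] then tile the circle: their lengths telescope to n,
-- and comparing the distances to a vertex w from ρ(i) and from λ(i) shows that w lies in exactly
-- one half-open interval [ρ(i), λ(i)), which gives (2) and (3).

module Submission where

open import Defs
open import Data.Nat using (ℕ; zero; suc; _+_; _∸_; _*_; _≤_; _<_; _≤ᵇ_; _<ᵇ_; _%_; z≤n; s≤s)
open import Data.Nat.Properties
open import Data.Nat.DivMod using (m%n<n; [m+n]%n≡m%n; m<n⇒m%n≡m; n%n≡0)
open import Data.Bool using (Bool; T; _∧_)
open import Data.Bool.Properties using (T-≡; T-∧)
open import Data.Fin using (Fin; toℕ; fromℕ; inject₁)
open import Data.Fin.Properties
  using (toℕ-fromℕ<; toℕ-injective; toℕ<n; toℕ-fromℕ; toℕ-inject₁; any?) renaming (_≟_ to _≟ᶠ_)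
open import Data.Fin.Subset
  using (Subset; _∈_; _∉_; _⊆_; _∩_; _∪_; _-_; ⁅_⁆; ∣_∣; ⊤; inside; outside; Nonempty; Empty) renaming (⊥ to ∅)
open import Data.Fin.Subset.Properties
  using ( _∈?_; _⊆?_; anySubset?; nonempty?; Empty-unique; ∣⊤∣≡n; ∣⊥∣≡0; ∣⁅x⁆∣≡1; x∈⁅x⁆; x∈⁅y⁆⇒x≡y
        ; p⊆q⇒∣p∣≤∣q∣; p⊂q⇒∣p∣<∣q∣; ∪-identityʳ; p─⊥≡p; p─q⊆p; x∈p∧x≢y⇒x∈p-y
        ; x∈p∪q⁺; x∈p∪q⁻; x∈p∩q⁻; x∈p∩q⁺ )
open import Data.Vec using (tabulate; _∷_; []; here; there)
open import Data.Vec.Properties using (lookup∘tabulate; []=⇒lookup; lookup⇒[]=)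
open import Data.Product using (∃; _×_; _,_; proj₁; proj₂)
open import Data.Sum as Sum using (_⊎_; inj₁; inj₂; [_,_]′)
open import Data.Empty using (⊥; ⊥-elim)
open import Function using (Equivalence; id; _∘_; flip; case_of_)
open import Relation.Nullary using (¬_; Dec; yes; no; ¬?; _×-dec_)
open import Relation.Nullary.Decidable using (decidable-stable)
open import Relation.Unary using (Decidable)
open import Relation.Binary.PropositionalEquality
open import Algebra.Properties.Semiring.Sum +-*-semiring
  using (sum; ∑-distrib-+; sum-cong-≗; sum-init-last; *-distribˡ-sum; sum-replicate-zero)
open import Data.Vec.Functional using (init; last)
open import Algebra.Properties.CommutativeSemigroup +-commutativeSemigroup using (xy∙z≈xz∙y)

∈-tabulate⁺ : ∀ {n} (f : Fin n → Bool) {x} → T (f x) → x ∈ tabulate f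
∈-tabulate⁺ f {x} fx = lookup⇒[]= x (tabulate f) (trans (lookup∘tabulate f x) (Equivalence.to T-≡ fx))

∈-tabulate⁻ : ∀ {n} (f : Fin n → Bool) {x} → x ∈ tabulate f → T (f x)
∈-tabulate⁻ f {x} x∈ = Equivalence.from T-≡ (trans (sym (lookup∘tabulate f x)) ([]=⇒lookup x∈))

∣p∪⁅x⁆∣ : ∀ {n} (p : Subset n) x → x ∉ p → ∣ p ∪ ⁅ x ⁆ ∣ ≡ suc ∣ p ∣
∣p∪⁅x⁆∣ (outside ∷ p) Fin.zero _ = cong suc (cong ∣_∣ (∪-identityʳ p))
∣p∪⁅x⁆∣ (inside ∷ p) Fin.zero x∉ = ⊥-elim (x∉ here)
∣p∪⁅x⁆∣ (outside ∷ p) (Fin.suc x) x∉ = ∣p∪⁅x⁆∣ p x (x∉ ∘ there)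
∣p∪⁅x⁆∣ (inside ∷ p) (Fin.suc x) x∉ = cong suc (∣p∪⁅x⁆∣ p x (x∉ ∘ there))

∣p-x∣ : ∀ {n} (p : Subset n) x → x ∈ p → suc ∣ p - x ∣ ≡ ∣ p ∣
∣p-x∣ (inside ∷ p) Fin.zero _ = cong suc (cong ∣_∣ (p─⊥≡p p))
∣p-x∣ (outside ∷ p) (Fin.suc x) (there x∈) = ∣p-x∣ p x x∈
∣p-x∣ (inside ∷ p) (Fin.suc x) (there x∈) = cong suc (∣p-x∣ p x x∈)

∈p-x⇒≢x : ∀ {n} (p : Subset n) x {y} → y ∈ p - x → y ≢ x
∈p-x⇒≢x (inside ∷ p) (Fin.suc x) here ()
∈p-x⇒≢x (_ ∷ p) Fin.zero (there y∈) ()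
∈p-x⇒≢x (_ ∷ p) (Fin.suc x) (there y∈) refl = ∈p-x⇒≢x p x y∈ refl

∣p∪q∣+∣p∩q∣ : ∀ {n} (p q : Subset n) → ∣ p ∪ q ∣ + ∣ p ∩ q ∣ ≡ ∣ p ∣ + ∣ q ∣
∣p∪q∣+∣p∩q∣ [] [] = refl
∣p∪q∣+∣p∩q∣ (outside ∷ p) (outside ∷ q) = ∣p∪q∣+∣p∩q∣ p q
∣p∪q∣+∣p∩q∣ (outside ∷ p) (inside ∷ q) =
  trans (cong suc (∣p∪q∣+∣p∩q∣ p q)) (sym (+-suc ∣ p ∣ ∣ q ∣))
∣p∪q∣+∣p∩q∣ (inside ∷ p) (outside ∷ q) = cong suc (∣p∪q∣+∣p∩q∣ p q)
∣p∪q∣+∣p∩q∣ (inside ∷ p) (inside ∷ q) = cong suc (trans (+-suc ∣ p ∪ q ∣ ∣ p ∩ q ∣)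
  (trans (cong suc (∣p∪q∣+∣p∩q∣ p q)) (sym (+-suc ∣ p ∣ ∣ q ∣))))

∃-subset-of-size : ∀ {n} k → k ≤ n → ∃ λ (p : Subset n) → ∣ p ∣ ≡ k
∃-subset-of-size {n} zero _ = ∅ , ∣⊥∣≡0 n
∃-subset-of-size {suc n} (suc k) (s≤s k≤n) with ∃-subset-of-size k k≤n
... | p , ∣p∣≡k = inside ∷ p , cong suc ∣p∣≡k

0<∣p∣⇒Nonempty : ∀ {n} {p : Subset n} → 0 < ∣ p ∣ → Nonempty p
0<∣p∣⇒Nonempty {n} {p} pos with nonempty? p
... | yes p≢∅ = p≢∅
... | no p≡∅ = ⊥-elim (>⇒≢ pos (trans (cong ∣_∣ (Empty-unique p≡∅)) (∣⊥∣≡0 n)))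

2≤∣p∣⇒∃-other : ∀ {n} {p : Subset n} → 2 ≤ ∣ p ∣ → ∀ z → ∃ λ y → y ∈ p × y ≢ z
2≤∣p∣⇒∃-other {p = p} 2≤ z with any? (λ y → (y ∈? p) ×-dec ¬? (y ≟ᶠ z))
... | yes other = other
... | no ∄other = ⊥-elim (<⇒≱ 2≤ (subst (∣ p ∣ ≤_) (∣⁅x⁆∣≡1 z) (p⊆q⇒∣p∣≤∣q∣ p⊆⁅z⁆)))
  where
  p⊆⁅z⁆ : p ⊆ ⁅ z ⁆
  p⊆⁅z⁆ {y} y∈ with y ≟ᶠ z
  ... | yes refl = x∈⁅x⁆ z
  ... | no y≢z = ⊥-elim (∄other (y , y∈ , y≢z))

∈∧∈∧≢⇒2≤∣p∣ : ∀ {n} {p : Subset n} {x y} → x ∈ p → y ∈ p → x ≢ y → 2 ≤ ∣ p ∣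
∈∧∈∧≢⇒2≤∣p∣ {p = p} {x} {y} x∈ y∈ x≢y = subst (_< ∣ p ∣) (∣⁅x⁆∣≡1 x)
  (p⊂q⇒∣p∣<∣q∣ ((λ z∈ → subst (_∈ p) (sym (x∈⁅y⁆⇒x≡y x z∈)) x∈) ,
                y , y∈ , x≢y ∘ sym ∘ x∈⁅y⁆⇒x≡y x))

replace : ∀ {n} → Subset n → Fin n → Fin n → Subset n
replace e a x = (e - a) ∪ ⁅ x ⁆

∣replace∣ : ∀ {n} (e : Subset n) {a x} → a ∈ e → x ∉ e → ∣ replace e a x ∣ ≡ ∣ e ∣
∣replace∣ e {a} {x} a∈ x∉ = trans (∣p∪⁅x⁆∣ (e - a) x (x∉ ∘ p─q⊆p e ⁅ a ⁆)) (∣p-x∣ e a a∈)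

∈-replace-kept : ∀ {n} {e : Subset n} {a x y} → y ∈ e → y ≢ a → y ∈ replace e a x
∈-replace-kept y∈ y≢a = x∈p∪q⁺ (inj₁ (x∈p∧x≢y⇒x∈p-y y∈ y≢a))

∈-replace-new : ∀ {n} {e : Subset n} {a x} → x ∈ replace e a x
∈-replace-new {x = x} = x∈p∪q⁺ (inj₂ (x∈⁅x⁆ x))

∈-replace⁻ : ∀ {n} {e : Subset n} {a x y} → y ∈ replace e a x → (y ∈ e × y ≢ a) ⊎ y ≡ x
∈-replace⁻ {e = e} {a} {x} y∈ with x∈p∪q⁻ (e - a) ⁅ x ⁆ y∈
... | inj₁ y∈e-a = inj₁ (p─q⊆p e ⁅ a ⁆ y∈e-a , ∈p-x⇒≢x e a y∈e-a)
... | inj₂ y∈⁅x⁆ = inj₂ (x∈⁅y⁆⇒x≡y x y∈⁅x⁆)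

∃-transition : (P : ℕ → Set) → (∀ k → Dec (P k)) → P 0 → ∀ K → ¬ P K →
               ∃ λ k → k < K × P k × ¬ P (suc k)
∃-transition P P? P0 zero ¬PK = ⊥-elim (¬PK P0)
∃-transition P P? P0 (suc K) ¬PK with P? K
... | yes PK = K , ≤-refl , PK , ¬PK
... | no ¬PK′ with ∃-transition P P? P0 K ¬PK′
...   | k , k<K , Pk , ¬Pk+1 = k , m<n⇒m<1+n k<K , Pk , ¬Pk+1

indicator : ∀ {P : Set} → Dec P → ℕ
indicator (yes _) = 1
indicator (no _) = 0

sum-const-1 : ∀ n → sum {n} (λ _ → 1) ≡ n
sum-const-1 zero = refl
sum-const-1 (suc n) = cong suc (sum-const-1 n)

term≤sum : ∀ {n} (f : Fin n → ℕ) i → f i ≤ sum f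
term≤sum f Fin.zero = m≤m+n (f Fin.zero) _
term≤sum f (Fin.suc i) = ≤-trans (term≤sum (f ∘ Fin.suc) i) (m≤n+m _ (f Fin.zero))

two-terms≤sum : ∀ {n} (f : Fin n → ℕ) i j → i ≢ j → f i + f j ≤ sum f
two-terms≤sum f Fin.zero Fin.zero i≢j = ⊥-elim (i≢j refl)
two-terms≤sum f Fin.zero (Fin.suc j) _ = +-monoʳ-≤ (f Fin.zero) (term≤sum (f ∘ Fin.suc) j)
two-terms≤sum f (Fin.suc i) Fin.zero _ =
  subst (_≤ sum f) (+-comm (f Fin.zero) _) (+-monoʳ-≤ (f Fin.zero) (term≤sum (f ∘ Fin.suc) i))
two-terms≤sum f (Fin.suc i) (Fin.suc j) i≢j =
  ≤-trans (two-terms≤sum (f ∘ Fin.suc) i j (i≢j ∘ cong Fin.suc)) (m≤n+m _ (f Fin.zero))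

module Cyclic (m : ℕ) where

  N : ℕ
  N = suc m

  Offset : Fin N → ℕ → Fin N → Set
  Offset a d x = (toℕ a + d ≡ toℕ x) ⊎ (toℕ a + d ≡ toℕ x + N)

  dist-offset : ∀ a x → Offset a (dist a x) x
  dist-offset a x with toℕ a ≤? toℕ x
  ... | yes a≤x = inj₁ (trans (cong (toℕ a +_) dist≡) (m+[n∸m]≡n a≤x))
    where
    open ≡-Reasoning
    dist≡ : dist a x ≡ toℕ x ∸ toℕ a
    dist≡ = begin
      (toℕ x + N ∸ toℕ a) % N  ≡⟨ cong (_% N) (+-∸-comm N a≤x) ⟩
      (toℕ x ∸ toℕ a + N) % N  ≡⟨ [m+n]%n≡m%n (toℕ x ∸ toℕ a) N ⟩
      (toℕ x ∸ toℕ a) % N      ≡⟨ m<n⇒m%n≡m (≤-<-trans (m∸n≤m (toℕ x) (toℕ a)) (toℕ<n x)) ⟩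
      toℕ x ∸ toℕ a            ∎
  ... | no a≰x = inj₂ (trans (cong (toℕ a +_) (m<n⇒m%n≡m lt)) (m+[n∸m]≡n a≤x+N))
    where
    a≤x+N : toℕ a ≤ toℕ x + N
    a≤x+N = ≤-trans (<⇒≤ (toℕ<n a)) (m≤n+m N (toℕ x))
    lt : toℕ x + N ∸ toℕ a < N
    lt = +-cancelˡ-< (toℕ a) _ N
           (subst (_< toℕ a + N) (sym (m+[n∸m]≡n a≤x+N)) (+-monoˡ-< N (≰⇒> a≰x)))

  -- δ is opaque so that its modular arithmetic is never unfolded during type checking.
  opaque
    δ : Fin N → Fin N → ℕ
    δ = dist

    δ≡dist : ∀ a x → δ a x ≡ dist a x
    δ≡dist a x = refl

  δ<N : ∀ a x → δ a x < N
  δ<N a x = subst (_< N) (sym (δ≡dist a x)) (m%n<n (toℕ x + N ∸ toℕ a) N)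

  δ-offset : ∀ a x → Offset a (δ a x) x
  δ-offset a x = subst (λ d → Offset a d x) (sym (δ≡dist a x)) (dist-offset a x)

  offset-unique : ∀ {a x d d′} → d < N → d′ < N → Offset a d x → Offset a d′ x → d ≡ d′
  offset-unique {a} _ _ (inj₁ p) (inj₁ q) = +-cancelˡ-≡ (toℕ a) _ _ (trans p (sym q))
  offset-unique {a} _ _ (inj₂ p) (inj₂ q) = +-cancelˡ-≡ (toℕ a) _ _ (trans p (sym q))
  offset-unique {a} {d = d} _ d′<N (inj₁ p) (inj₂ q) =
    ⊥-elim (m+n≮n d N (subst (_< N) (+-cancelˡ-≡ (toℕ a) _ _ eq) d′<N))
    where
    eq : toℕ a + _ ≡ toℕ a + (d + N)
    eq = trans q (trans (cong (_+ N) (sym p)) (+-assoc (toℕ a) d N))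
  offset-unique {a} {d′ = d′} d<N _ (inj₂ p) (inj₁ q) =
    ⊥-elim (m+n≮n d′ N (subst (_< N) (+-cancelˡ-≡ (toℕ a) _ _ eq) d<N))
    where
    eq : toℕ a + _ ≡ toℕ a + (d′ + N)
    eq = trans p (trans (cong (_+ N) (sym q)) (+-assoc (toℕ a) d′ N))

  δ-unique : ∀ {a x d} → d < N → Offset a d x → δ a x ≡ d
  δ-unique {a} {x} d<N o = offset-unique (δ<N a x) d<N (δ-offset a x) o

  offset-injectiveʳ : ∀ {a x y d} → Offset a d x → Offset a d y → x ≡ y
  offset-injectiveʳ (inj₁ p) (inj₁ q) = toℕ-injective (trans (sym p) q)
  offset-injectiveʳ (inj₂ p) (inj₂ q) = toℕ-injective (+-cancelʳ-≡ N _ _ (trans (sym p) q))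
  offset-injectiveʳ {x = x} {y} (inj₁ p) (inj₂ q) =
    ⊥-elim (<⇒≱ (toℕ<n x) (subst (N ≤_) (trans (sym q) p) (m≤n+m N (toℕ y))))
  offset-injectiveʳ {x = x} {y} (inj₂ p) (inj₁ q) =
    ⊥-elim (<⇒≱ (toℕ<n y) (subst (N ≤_) (trans (sym p) q) (m≤n+m N (toℕ x))))

  offset-injectiveˡ : ∀ {a b x d} → Offset a d x → Offset b d x → a ≡ b
  offset-injectiveˡ {d = d} (inj₁ p) (inj₁ q) = toℕ-injective (+-cancelʳ-≡ d _ _ (trans p (sym q)))
  offset-injectiveˡ {d = d} (inj₂ p) (inj₂ q) = toℕ-injective (+-cancelʳ-≡ d _ _ (trans p (sym q)))
  offset-injectiveˡ {a} {b} {d = d} (inj₁ p) (inj₂ q) =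
    ⊥-elim (<⇒≱ (toℕ<n b) (subst (N ≤_) eq (m≤n+m N (toℕ a))))
    where
    eq : toℕ a + N ≡ toℕ b
    eq = +-cancelʳ-≡ d _ _ (sym (trans q (trans (cong (_+ N) (sym p)) (xy∙z≈xz∙y (toℕ a) d N))))
  offset-injectiveˡ {a} {b} {d = d} (inj₂ p) (inj₁ q) =
    ⊥-elim (<⇒≱ (toℕ<n a) (subst (N ≤_) eq (m≤n+m N (toℕ b))))
    where
    eq : toℕ b + N ≡ toℕ a
    eq = +-cancelʳ-≡ d _ _ (sym (trans p (trans (cong (_+ N) (sym q)) (xy∙z≈xz∙y (toℕ b) d N))))

  δ-injective : ∀ a {x y} → δ a x ≡ δ a y → x ≡ y
  δ-injective a {x} {y} eq =
    offset-injectiveʳ {a} (δ-offset a x) (subst (λ d → Offset a d y) (sym eq) (δ-offset a y))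

  δ-self : ∀ a → δ a a ≡ 0
  δ-self a = δ-unique (s≤s z≤n) (inj₁ (+-identityʳ (toℕ a)))

  δ≡0⇒≡ : ∀ a {x} → δ a x ≡ 0 → a ≡ x
  δ≡0⇒≡ a eq = δ-injective a (trans (δ-self a) (sym eq))

  δ-self≤ : ∀ a x → δ a a ≤ δ a x
  δ-self≤ a x = subst (_≤ δ a x) (sym (δ-self a)) z≤n

  δ-pos : ∀ {a x} → a ≢ x → 0 < δ a x
  δ-pos {a} {x} a≢x with δ a x in eq
  ... | zero  = ⊥-elim (a≢x (δ≡0⇒≡ a eq))
  ... | suc _ = s≤s z≤n

  Offset≤2 : Fin N → ℕ → Fin N → Set
  Offset≤2 a d x = (toℕ a + d ≡ toℕ x) ⊎ (toℕ a + d ≡ toℕ x + N) ⊎ (toℕ a + d ≡ toℕ x + N + N)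

  offset-sum : ∀ {u p x d₁ d₂} → Offset u d₁ p → Offset p d₂ x → Offset≤2 u (d₁ + d₂) x
  offset-sum {u} {p′} {d₁ = d₁} {d₂} = go
    where
    reassoc : toℕ u + (d₁ + d₂) ≡ toℕ u + d₁ + d₂
    reassoc = sym (+-assoc (toℕ u) d₁ d₂)
    turned : ∀ {y} → toℕ p′ + d₂ ≡ y → toℕ p′ + N + d₂ ≡ y + N
    turned q = trans (xy∙z≈xz∙y (toℕ p′) N d₂) (cong (_+ N) q)
    go : Offset u d₁ p′ → Offset p′ d₂ _ → _
    go (inj₁ p) (inj₁ q) = inj₁ (trans reassoc (trans (cong (_+ d₂) p) q))
    go (inj₁ p) (inj₂ q) = inj₂ (inj₁ (trans reassoc (trans (cong (_+ d₂) p) q)))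
    go (inj₂ p) (inj₁ q) = inj₂ (inj₁ (trans reassoc (trans (cong (_+ d₂) p) (turned q))))
    go (inj₂ p) (inj₂ q) = inj₂ (inj₂ (trans reassoc (trans (cong (_+ d₂) p) (turned q))))

  offset-+ : ∀ {u p x d₁ d₂} → Offset u d₁ p → Offset p d₂ x → d₁ + d₂ < N → Offset u (d₁ + d₂) x
  offset-+ {u} {x = x} o₁ o₂ d<N with offset-sum {u} o₁ o₂
  ... | inj₁ eq = inj₁ eq
  ... | inj₂ (inj₁ eq) = inj₂ eq
  ... | inj₂ (inj₂ eq) =
    ⊥-elim (<⇒≱ (+-mono-< (toℕ<n u) d<N) (subst (N + N ≤_) (sym eq) (+-monoˡ-≤ N (m≤n+m N (toℕ x)))))

  offset-+∸ : ∀ {u p x d₁ d₂} → Offset u d₁ p → Offset p d₂ x → N ≤ d₁ + d₂ → Offset u (d₁ + d₂ ∸ N) x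
  offset-+∸ {u} {x = x} {d₁} {d₂} o₁ o₂ N≤ = reduce (offset-sum {u} o₁ o₂)
    where
    one-turn-less : ∀ {y} → toℕ u + (d₁ + d₂) ≡ y + N → toℕ u + (d₁ + d₂ ∸ N) ≡ y
    one-turn-less eq = +-cancelʳ-≡ N _ _ (trans (+-assoc (toℕ u) _ N) (trans (cong (toℕ u +_) (m∸n+n≡m N≤)) eq))
    reduce : Offset≤2 u (d₁ + d₂) x → Offset u (d₁ + d₂ ∸ N) x
    reduce (inj₁ eq) = ⊥-elim (<⇒≱ (toℕ<n x) (subst (N ≤_) eq (≤-trans N≤ (m≤n+m (d₁ + d₂) (toℕ u)))))
    reduce (inj₂ (inj₁ eq)) = inj₁ (one-turn-less eq)
    reduce (inj₂ (inj₂ eq)) = inj₂ (one-turn-less eq)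

  δ-triangle : ∀ u p x → (δ u p + δ p x ≡ δ u x) ⊎ (δ u p + δ p x ≡ δ u x + N)
  δ-triangle u p x with δ u p + δ p x <? N
  ... | yes lt = inj₁ (sym (δ-unique lt (offset-+ (δ-offset u p) (δ-offset p x) lt)))
  ... | no ≮ = inj₂ (trans (sym (m∸n+n≡m N≤))
                 (cong (_+ N) (sym (δ-unique lt (offset-+∸ (δ-offset u p) (δ-offset p x) N≤)))))
    where
    N≤ : N ≤ δ u p + δ p x
    N≤ = ≮⇒≥ ≮
    lt : δ u p + δ p x ∸ N < N
    lt = +-cancelʳ-< N _ _ (subst (_< N + N) (sym (m∸n+n≡m N≤)) (+-mono-< (δ<N u p) (δ<N p x)))

  δ-additive : ∀ u p x → δ u p ≤ δ u x → δ u p + δ p x ≡ δ u x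
  δ-additive u p x up≤ux with δ-triangle u p x
  ... | inj₁ eq = eq
  ... | inj₂ eq =
    ⊥-elim (<⇒≱ (δ<N p x) (+-cancelˡ-≤ (δ u p) N _ (subst (δ u p + N ≤_) (sym eq) (+-monoˡ-≤ N up≤ux))))

  δ-wraps : ∀ u p x → δ u x < δ u p → δ u p + δ p x ≡ δ u x + N
  δ-wraps u p x ux<up with δ-triangle u p x
  ... | inj₁ eq = ⊥-elim (<⇒≱ ux<up (subst (δ u p ≤_) eq (m≤m+n (δ u p) (δ p x))))
  ... | inj₂ eq = eq

  δ-split : ∀ u p x → (δ u p ≤ δ u x × δ u p + δ p x ≡ δ u x)
                    ⊎ (δ u x < δ u p × δ u p + δ p x ≡ δ u x + N)
  δ-split u p x with δ u p ≤? δ u x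
  ... | yes up≤ux = inj₁ (up≤ux , δ-additive u p x up≤ux)
  ... | no up≰ux = inj₂ (≰⇒> up≰ux , δ-wraps u p x (≰⇒> up≰ux))

  δ+δ-flip : ∀ p q → p ≢ q → δ p q + δ q p ≡ N
  δ+δ-flip p q p≢q = trans (δ-wraps p q p (subst (_< δ p q) (sym (δ-self p)) (δ-pos p≢q))) (cong (_+ N) (δ-self p))

  δ-rebase-< : ∀ u {p x y} → δ u p ≤ δ u x → δ u p ≤ δ u y → δ u x < δ u y → δ p x < δ p y
  δ-rebase-< u {p} {x} {y} p≤x p≤y x<y =
    +-cancelˡ-< (δ u p) _ _ (subst₂ _<_ (sym (δ-additive u p x p≤x)) (sym (δ-additive u p y p≤y)) x<y)

  δ-suffix-< : ∀ {a b y z} → δ a y < δ a b → δ y z < δ y b → δ a z < δ a b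
  δ-suffix-< {a} {b} {y} {z} y<b z<b with δ-split a y z
  ... | inj₁ (_ , eq) =
    subst (_< δ a b) eq (subst (δ a y + δ y z <_) (δ-additive a y b (<⇒≤ y<b)) (+-monoʳ-< (δ a y) z<b))
  ... | inj₂ (_ , eq) = ⊥-elim (m+n≮n (δ a z) N (<-trans
          (subst₂ _<_ eq (δ-additive a y b (<⇒≤ y<b)) (+-monoʳ-< (δ a y) z<b)) (δ<N a b)))

  δ-complement-< : ∀ {p q z} → p ≢ q → δ q p ≤ δ q z → δ p z < δ p q
  δ-complement-< {p} {q} {z} p≢q p≤z = +-cancelˡ-< (δ q p) _ _
    (subst₂ _<_ (sym (δ-additive q p z p≤z)) (sym (trans (+-comm (δ q p) (δ p q)) (δ+δ-flip p q p≢q))) (δ<N q z))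

  ∈-cc⁺ : ∀ {p q x} → δ p x ≤ δ p q → x ∈ cc p q
  ∈-cc⁺ {p} {q} {x} le =
    ∈-tabulate⁺ (λ y → dist p y ≤ᵇ dist p q) (≤⇒≤ᵇ (subst₂ _≤_ (δ≡dist p x) (δ≡dist p q) le))

  ∈-cc⁻ : ∀ {p q x} → x ∈ cc p q → δ p x ≤ δ p q
  ∈-cc⁻ {p} {q} {x} x∈ = subst₂ _≤_ (sym (δ≡dist p x)) (sym (δ≡dist p q))
    (≤ᵇ⇒≤ (dist p x) (dist p q) (∈-tabulate⁻ (λ y → dist p y ≤ᵇ dist p q) x∈))

  ∈-co⁺ : ∀ {p q x} → δ p x < δ p q → x ∈ co p q
  ∈-co⁺ {p} {q} {x} lt =
    ∈-tabulate⁺ (λ y → dist p y <ᵇ dist p q) (<⇒<ᵇ (subst₂ _<_ (δ≡dist p x) (δ≡dist p q) lt))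

  ∈-oo⁺ : ∀ {p q x} → 0 < δ p x → δ p x < δ p q → x ∈ oo p q
  ∈-oo⁺ {p} {q} {x} pos lt = ∈-tabulate⁺ (λ y → (0 <ᵇ dist p y) ∧ (dist p y <ᵇ dist p q))
    (Equivalence.from T-∧ (<⇒<ᵇ (subst (0 <_) (δ≡dist p x) pos) ,
                           <⇒<ᵇ (subst₂ _<_ (δ≡dist p x) (δ≡dist p q) lt)))

  ∈-oo⁻ : ∀ {p q x} → x ∈ oo p q → 0 < δ p x × δ p x < δ p q
  ∈-oo⁻ {p} {q} {x} x∈
    with Equivalence.to T-∧ (∈-tabulate⁻ (λ y → (0 <ᵇ dist p y) ∧ (dist p y <ᵇ dist p q)) x∈)
  ... | pos , lt = subst (0 <_) (sym (δ≡dist p x)) (<ᵇ⇒< 0 (dist p x) pos)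
                 , subst₂ _<_ (sym (δ≡dist p x)) (sym (δ≡dist p q)) (<ᵇ⇒< (dist p x) (dist p q) lt)

  ∈-cc-self : ∀ s t → s ∈ cc s t
  ∈-cc-self s t = ∈-cc⁺ (δ-self≤ s t)

  ∈-cc-end : ∀ s t → t ∈ cc s t
  ∈-cc-end s t = ∈-cc⁺ {s} ≤-refl

  cc-singleton : ∀ {s x} → x ∈ cc s s → x ≡ s
  cc-singleton {s} {x} x∈ = sym (δ≡0⇒≡ s (n≤0⇒n≡0 (subst (δ s x ≤_) (δ-self s) (∈-cc⁻ x∈))))

  ∈-cc-from⁺ : ∀ u {p q x} → δ u p ≤ δ u x → δ u x ≤ δ u q → x ∈ cc p q
  ∈-cc-from⁺ u {p} {q} {x} p≤x x≤q = ∈-cc⁺ (+-cancelˡ-≤ (δ u p) _ _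
    (subst₂ _≤_ (sym (δ-additive u p x p≤x)) (sym (δ-additive u p q (≤-trans p≤x x≤q))) x≤q))

  ∈-cc-from⁻ : ∀ u {p q x} → δ u p ≤ δ u q → x ∈ cc p q → δ u p ≤ δ u x × δ u x ≤ δ u q
  ∈-cc-from⁻ u {p} {q} {x} p≤q x∈ with δ-split u p x
  ... | inj₁ (p≤x , eq) = p≤x , subst₂ _≤_ eq (δ-additive u p q p≤q) (+-monoʳ-≤ (δ u p) (∈-cc⁻ x∈))
  ... | inj₂ (_ , eq) = ⊥-elim (<⇒≱ (δ<N u q) (≤-trans (m≤m+n N (δ u x))
        (subst₂ _≤_ (+-comm (δ u x) N) (δ-additive u p q p≤q)
          (subst (_≤ δ u p + δ p q) eq (+-monoʳ-≤ (δ u p) (∈-cc⁻ x∈))))))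

  ∈-cc-wrap⁺ : ∀ u {p q x} → δ u q < δ u p → δ u p ≤ δ u x ⊎ δ u x ≤ δ u q → x ∈ cc p q
  ∈-cc-wrap⁺ u {p} {q} {x} q<p x∈ =
    ∈-cc⁺ (+-cancelˡ-≤ (δ u p) _ _
      (subst (δ u p + δ p x ≤_) (sym (δ-wraps u p q q<p)) (bound (δ-split u p x) x∈)))
    where
    bound : _ → δ u p ≤ δ u x ⊎ δ u x ≤ δ u q → δ u p + δ p x ≤ δ u q + N
    bound (inj₁ (_ , eq)) _ = subst (_≤ δ u q + N) (sym eq) (≤-trans (<⇒≤ (δ<N u x)) (m≤n+m N (δ u q)))
    bound (inj₂ (x<p , _)) (inj₁ p≤x) = ⊥-elim (<⇒≱ x<p p≤x)
    bound (inj₂ (_ , eq)) (inj₂ x≤q) = subst (_≤ δ u q + N) (sym eq) (+-monoˡ-≤ N x≤q)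

  ∉-cc⇒unwrapped : ∀ u s t → u ∉ cc s t → δ u s ≤ δ u t
  ∉-cc⇒unwrapped u s t u∉ with δ u s ≤? δ u t
  ... | yes s≤t = s≤t
  ... | no s≰t = ⊥-elim (u∉ (∈-cc-wrap⁺ u (≰⇒> s≰t) (inj₂ (δ-self≤ u t))))

  arc-below : ∀ u {s t y w x} → δ u s ≤ δ u t → y ∈ cc s t → w ∉ cc s t → δ u y < δ u w →
              x ∈ cc s t → δ u x < δ u w
  arc-below u {s} {t} {y} {w} {x} s≤t y∈ w∉ y<w x∈ with δ u w ≤? δ u t
  ... | yes w≤t = ⊥-elim (w∉ (∈-cc-from⁺ u (≤-trans (proj₁ (∈-cc-from⁻ u s≤t y∈)) (<⇒≤ y<w)) w≤t))
  ... | no w≰t = ≤-<-trans (proj₂ (∈-cc-from⁻ u s≤t x∈)) (≰⇒> w≰t)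

  arc-above : ∀ u {s t y w x} → δ u s ≤ δ u t → y ∈ cc s t → w ∉ cc s t → δ u w < δ u y →
              x ∈ cc s t → δ u w < δ u x
  arc-above u {s} {t} {y} {w} {x} s≤t y∈ w∉ w<y x∈ with δ u s ≤? δ u w
  ... | yes s≤w = ⊥-elim (w∉ (∈-cc-from⁺ u s≤w (≤-trans (<⇒≤ w<y) (proj₂ (∈-cc-from⁻ u s≤t y∈)))))
  ... | no s≰w = <-≤-trans (≰⇒> s≰w) (proj₁ (∈-cc-from⁻ u s≤t x∈))

  oo-∩-cc : ∀ {a b y} → y ∈ oo b a → y ∉ cc a b
  oo-∩-cc {a} {b} {y} y∈oo y∈cc with ∈-oo⁻ y∈oo | δ-split a b y
  ... | pos , _ | inj₁ (b≤y , eq) = <⇒≢ pos (sym (+-cancelˡ-≡ (δ a b) _ _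
          (trans eq (trans (≤-antisym (∈-cc⁻ y∈cc) b≤y) (sym (+-identityʳ (δ a b)))))))
  ... | _ , y<a | inj₂ (_ , eq) with b ≟ᶠ a
  ...   | yes refl = ⊥-elim (<⇒≱ y<a (δ-self≤ b y))
  ...   | no b≢a =
    ⊥-elim (<⇒≱ (subst₂ _<_ eq (δ+δ-flip a b (b≢a ∘ sym)) (+-monoʳ-< (δ a b) y<a)) (m≤n+m N (δ a y)))

  ∉-cc⇒∈-oo : ∀ {s t y} → s ≢ t → y ∉ cc s t → y ∈ oo t s
  ∉-cc⇒∈-oo {s} {t} {y} s≢t y∉ = ∈-oo⁺ pos lt
    where
    t<y : δ s t < δ s y
    t<y = ≰⇒> (y∉ ∘ ∈-cc⁺)
    eq : δ s t + δ t y ≡ δ s y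
    eq = δ-additive s t y (<⇒≤ t<y)
    pos : 0 < δ t y
    pos = δ-pos (λ t≡y → <-irrefl (cong (δ s) t≡y) t<y)
    lt : δ t y < δ t s
    lt = +-cancelˡ-< (δ s t) _ _ (subst₂ _<_ (sym eq) (sym (δ+δ-flip s t s≢t)) (δ<N s y))

  offset-next : ∀ i → Offset i 1 (next i)
  offset-next i with suc (toℕ i) <? N
  ... | yes lt = inj₁ (trans (+-comm (toℕ i) 1) (sym (trans (toℕ-fromℕ< (m%n<n (suc (toℕ i)) N)) (m<n⇒m%n≡m lt))))
  ... | no ≮ = inj₂ (trans (+-comm (toℕ i) 1) (trans i+1≡N (cong (_+ N) (sym toℕ-next≡0))))
    where
    i+1≡N : suc (toℕ i) ≡ N
    i+1≡N = ≤-antisym (toℕ<n i) (≮⇒≥ ≮)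
    toℕ-next≡0 : toℕ (next i) ≡ 0
    toℕ-next≡0 = trans (toℕ-fromℕ< (m%n<n (suc (toℕ i)) N)) (trans (cong (_% N) i+1≡N) (n%n≡0 N))

  toℕ-prev-zero : toℕ (prev {N} Fin.zero) ≡ m
  toℕ-prev-zero = trans (toℕ-fromℕ< (m%n<n m N)) (m<n⇒m%n≡m (n<1+n m))

  toℕ-prev-suc : ∀ k → toℕ (prev {N} (Fin.suc k)) ≡ toℕ k
  toℕ-prev-suc k = begin
    toℕ (prev (Fin.suc k))  ≡⟨ toℕ-fromℕ< (m%n<n (suc (toℕ k) + m) N) ⟩
    (suc (toℕ k) + m) % N  ≡⟨ cong (_% N) (+-suc (toℕ k) m) ⟨
    (toℕ k + N) % N        ≡⟨ [m+n]%n≡m%n (toℕ k) N ⟩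
    toℕ k % N              ≡⟨ m<n⇒m%n≡m (<-trans (toℕ<n k) (n<1+n m)) ⟩
    toℕ k                  ∎
    where open ≡-Reasoning

  offset-prev : ∀ i → Offset (prev i) 1 i
  offset-prev Fin.zero = inj₂ (trans (cong (_+ 1) toℕ-prev-zero) (+-comm m 1))
  offset-prev (Fin.suc k) = inj₁ (trans (cong (_+ 1) (toℕ-prev-suc k)) (+-comm (toℕ k) 1))

  sum-∘prev : ∀ (f : Fin N → ℕ) → sum (f ∘ prev) ≡ sum f
  sum-∘prev f = begin
    f (prev Fin.zero) + sum (f ∘ prev ∘ Fin.suc)
      ≡⟨ cong₂ _+_ (cong f prev-zero) (sum-cong-≗ (cong f ∘ prev-suc)) ⟩
    last f + sum (init f)  ≡⟨ +-comm (last f) _ ⟩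
    sum (init f) + last f  ≡⟨ sum-init-last f ⟨
    sum f                  ∎
    where
    open ≡-Reasoning
    prev-zero : prev Fin.zero ≡ fromℕ m
    prev-zero = toℕ-injective (trans toℕ-prev-zero (sym (toℕ-fromℕ m)))
    prev-suc : ∀ k → prev (Fin.suc k) ≡ inject₁ k
    prev-suc k = toℕ-injective (trans (toℕ-prev-suc k) (sym (toℕ-inject₁ k)))

  module NextPrev (1<N : 1 < N) where

    δ-next : ∀ i → δ i (next i) ≡ 1
    δ-next i = δ-unique 1<N (offset-next i)

    δ-prev : ∀ i → δ (prev i) i ≡ 1
    δ-prev i = δ-unique 1<N (offset-prev i)

    next-prev : ∀ i → next (prev i) ≡ i
    next-prev i = offset-injectiveʳ {prev i} (offset-next (prev i)) (offset-prev i)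

    prev-next : ∀ i → prev (next i) ≡ i
    prev-next i = offset-injectiveˡ {prev (next i)} (offset-prev (next i)) (offset-next i)

    next≢ : ∀ i → next i ≢ i
    next≢ i eq = 1+n≢0 (trans (sym (δ-next i)) (trans (cong (δ i) eq) (δ-self i)))

    prev≢ : ∀ i → prev i ≢ i
    prev≢ i eq = next≢ (prev i) (trans (next-prev i) (sym eq))

    δ-next-self : ∀ z → δ (next z) z ≡ m
    δ-next-self z =
      +-cancelˡ-≡ 1 _ _ (trans (cong (_+ δ (next z) z) (sym (δ-next z))) (δ+δ-flip z (next z) (next≢ z ∘ sym)))

    δ-prev-self : ∀ i → δ i (prev i) ≡ m
    δ-prev-self i =
      +-cancelˡ-≡ 1 _ _ (trans (cong (_+ δ i (prev i)) (sym (δ-prev i))) (δ+δ-flip (prev i) i (prev≢ i)))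

    δ≤δ-next-self : ∀ z x → δ (next z) x ≤ δ (next z) z
    δ≤δ-next-self z x = subst (δ (next z) x ≤_) (sym (δ-next-self z)) (≤-pred (δ<N (next z) x))

    δ-next-suc : ∀ u x → suc (δ u x) < N → δ u (next x) ≡ suc (δ u x)
    δ-next-suc u x lt = conclude (δ-triangle u x (next x))
      where
      step : δ u x + δ x (next x) ≡ suc (δ u x)
      step = trans (cong (δ u x +_) (δ-next x)) (+-comm (δ u x) 1)
      conclude : _ → δ u (next x) ≡ suc (δ u x)
      conclude (inj₁ eq) = trans (sym eq) step
      conclude (inj₂ eq) = ⊥-elim (<⇒≱ lt (subst (N ≤_) (trans (sym eq) step) (m≤n+m N _)))

    δ-prev-suc : ∀ u x → 0 < δ u x → suc (δ u (prev x)) ≡ δ u x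
    δ-prev-suc u x pos = conclude (δ-triangle u (prev x) x)
      where
      step : δ u (prev x) + δ (prev x) x ≡ suc (δ u (prev x))
      step = trans (cong (δ u (prev x) +_) (δ-prev x)) (+-comm _ 1)
      conclude : _ → suc (δ u (prev x)) ≡ δ u x
      conclude (inj₁ eq) = trans (sym step) eq
      conclude (inj₂ eq) =
        ⊥-elim (<⇒≱ (δ<N u (prev x)) (≤-pred (subst (suc N ≤_) (trans (sym eq) step) (+-monoˡ-≤ N pos))))

    next-δ≡N : ∀ u x → suc (δ u x) ≡ N → next x ≡ u
    next-δ≡N u x δ+1≡N = conclude (δ-triangle u x (next x))
      where
      step : δ u x + δ x (next x) ≡ N
      step = trans (cong (δ u x +_) (δ-next x)) (trans (+-comm (δ u x) 1) δ+1≡N)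
      conclude : _ → next x ≡ u
      conclude (inj₁ eq) = ⊥-elim (<-irrefl (trans (sym eq) step) (δ<N u (next x)))
      conclude (inj₂ eq) = sym (δ≡0⇒≡ u (+-cancelʳ-≡ N _ 0 (trans (sym eq) step)))

    ∉-cc⇒unwrapped-next : ∀ z s t → z ∉ cc s t → δ (next z) s ≤ δ (next z) t
    ∉-cc⇒unwrapped-next z s t z∉ with δ (next z) s ≤? δ (next z) t
    ... | yes s≤t = s≤t
    ... | no s≰t = ⊥-elim (z∉ (∈-cc-wrap⁺ (next z) (≰⇒> s≰t) (inj₁ (δ≤δ-next-self z s))))

    cc-shrinkˡ : ∀ {a v x} → x ∈ cc a v → x ≢ a → x ∈ cc (next a) v
    cc-shrinkˡ {a} {x = x} x∈ x≢a =
      ∈-cc-from⁺ a (subst (_≤ δ a x) (sym (δ-next a)) (δ-pos (x≢a ∘ sym))) (∈-cc⁻ x∈)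

    cc-shrinkʳ : ∀ {a v x} → x ∈ cc a v → x ≢ v → x ∈ cc a (prev v)
    cc-shrinkʳ {a} {v} {x} x∈ x≢v = ∈-cc-from⁺ a (δ-self≤ a x)
      (≤-pred (subst (suc (δ a x) ≤_) (sym (δ-prev-suc a v (≤-<-trans z≤n x<v))) x<v))
      where
      x<v : δ a x < δ a v
      x<v = ≤∧≢⇒< (∈-cc⁻ x∈) (x≢v ∘ δ-injective a)

    oo⊆cc : ∀ {a b y} → y ∈ oo b a → y ∈ cc (next b) (prev a)
    oo⊆cc {a} {b} {y} y∈ with ∈-oo⁻ y∈
    ... | pos , y<a = ∈-cc-from⁺ b (subst (_≤ δ b y) (sym (δ-next b)) pos)
      (≤-pred (subst (suc (δ b y) ≤_) (sym (δ-prev-suc b a (<-trans pos y<a))) y<a))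

    oo-hull-∩-cc : ∀ {a b z y} → z ∈ oo b a → y ∈ cc a b → y ∉ cc (next b) (prev a)
    oo-hull-∩-cc {a} {b} {z} {y} z∈ y∈ y∈hull with ∈-oo⁻ {b} {a} z∈
    ... | z-pos , z<a = oo-∩-cc {a} {b} (∈-oo⁺ pos y<a) y∈
      where
      a-1 : suc (δ b (prev a)) ≡ δ b a
      a-1 = δ-prev-suc b a (<-trans z-pos z<a)
      unwrapped : δ b (next b) ≤ δ b (prev a)
      unwrapped = subst (_≤ δ b (prev a)) (sym (δ-next b))
        (≤-trans z-pos (≤-pred (subst (suc (δ b z) ≤_) (sym a-1) z<a)))
      y∈′ = ∈-cc-from⁻ b unwrapped y∈hull
      pos : 0 < δ b y
      pos = subst (_≤ δ b y) (δ-next b) (proj₁ y∈′)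
      y<a : δ b y < δ b a
      y<a = subst (δ b y <_) a-1 (s≤s (proj₂ y∈′))

    pt : Fin N → ℕ → Fin N
    pt b zero = b
    pt b (suc k) = next (pt b k)

    δ-pt : ∀ b k → k < N → δ b (pt b k) ≡ k
    δ-pt b zero _ = δ-self b
    δ-pt b (suc k) k+1<N = begin
      δ b (next (pt b k))  ≡⟨ δ-next-suc b (pt b k) (subst (λ d → suc d < N) (sym IH) k+1<N) ⟩
      suc (δ b (pt b k))   ≡⟨ cong suc IH ⟩
      suc k                ∎
      where
      open ≡-Reasoning
      IH = δ-pt b k (<-trans (n<1+n k) k+1<N)

    ∈-cc-pt⁺ : ∀ b k {x} → k < N → δ b x ≤ k → x ∈ cc b (pt b k)
    ∈-cc-pt⁺ b k {x} k<N le = ∈-cc⁺ (subst (δ b x ≤_) (sym (δ-pt b k k<N)) le)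

    ∈-cc-pt⁻ : ∀ b k {x} → k < N → x ∈ cc b (pt b k) → δ b x ≤ k
    ∈-cc-pt⁻ b k {x} k<N x∈ = subst (δ b x ≤_) (δ-pt b k k<N) (∈-cc⁻ x∈)

    pt-m : ∀ b → pt b m ≡ prev b
    pt-m b = δ-injective b (trans (δ-pt b m ≤-refl) (sym (δ-prev-self b)))

    pt-next-m : ∀ z → pt (next z) m ≡ z
    pt-next-m z = δ-injective (next z) (trans (δ-pt (next z) m ≤-refl) (sym (δ-next-self z)))

    ∈-cc-next-self : ∀ z x → x ∈ cc (next z) z
    ∈-cc-next-self z x = ∈-cc⁺ (δ≤δ-next-self z x)

    ∈-cc-prev : ∀ b x → x ∈ cc b (prev b)
    ∈-cc-prev b x = ∈-cc⁺ (subst (δ b x ≤_) (sym (δ-prev-self b)) (≤-pred (δ<N b x)))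

module UniformHypergraph
  (m : ℕ) (1<N : 1 < suc m) (r : ℕ) (2≤r : 2 ≤ r)
  (H : Hypergraph (suc m)) (uniform : ∀ h → H h → ∣ h ∣ ≡ r) where

  open Cyclic m
  open NextPrev 1<N

  Avoids : Subset N → Subset N → Set
  Avoids f I = ∀ {y} → y ∈ f → y ∉ I

  edge-nonempty : ∀ {h} → H h → Nonempty h
  edge-nonempty {h} h∈H = 0<∣p∣⇒Nonempty (subst (0 <_) (sym (uniform h h∈H)) (≤-trans (s≤s z≤n) 2≤r))

  edge-∃-other : ∀ {h} → H h → ∀ z → ∃ λ y → y ∈ h × y ≢ z
  edge-∃-other {h} h∈H = 2≤∣p∣⇒∃-other (subst (2 ≤_) (sym (uniform h h∈H)) 2≤r)

  arc-of-edge-nondegenerate : ∀ {h s t} → H h → h ⊆ cc s t → s ≢ t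
  arc-of-edge-nondegenerate {s = s} h∈H h⊆ refl with edge-nonempty h∈H
  ... | x , x∈ with edge-∃-other h∈H x
  ...   | y , y∈ , y≢x = y≢x (trans (cc-singleton {s} (h⊆ y∈)) (sym (cc-singleton {s} (h⊆ x∈))))

  arc-separation⇒FormCopy : ∀ {e h s t} → H h → h ⊆ cc s t → Avoids e (cc s t) → FormCopy e h
  arc-separation⇒FormCopy {e} {h} {s} {t} h∈H h⊆ e-avoids =
    inj₂ (disjoint , s , t , h⊆ , ∉-cc⇒∈-oo {s} {t} (arc-of-edge-nondegenerate {h} {s} {t} h∈H h⊆) ∘ e-avoids)
    where
    disjoint : Empty (h ∩ e)
    disjoint (x , x∈) with x∈p∩q⁻ h e x∈
    ... | x∈h , x∈e = e-avoids x∈e (h⊆ x∈h)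

  FormCopy⇒arc-separation : ∀ {f h} → H h → FormCopy f h → ∃ λ s → ∃ λ t → h ⊆ cc s t × Avoids f (cc s t)
  FormCopy⇒arc-separation h∈H (inj₂ (_ , a , b , h⊆ , f⊆)) = a , b , h⊆ , λ y∈ → oo-∩-cc {a} {b} (f⊆ y∈)
  FormCopy⇒arc-separation {f} {h} h∈H (inj₁ (_ , a , b , f⊆ , h⊆)) with edge-nonempty h∈H
  ... | z , z∈ = next b , prev a , oo⊆cc ∘ h⊆ , λ y∈ → oo-hull-∩-cc (h⊆ z∈) (f⊆ y∈)

  lam≢ : ∀ {x j} → IsLambda H x j → j ≢ x
  lam≢ {x} ((h , h∈H , _ , h⊆) , _) refl = arc-of-edge-nondegenerate {h} {x} {x} h∈H h⊆ refl

  rho≢ : ∀ {x j} → IsRho H x j → j ≢ x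
  rho≢ {x} ((h , h∈H , _ , h⊆) , _) refl = arc-of-edge-nondegenerate {h} {x} {x} h∈H h⊆ refl

  lam-edge : ∀ {x j} → IsLambda H x j → ∃ λ e → H e × x ∈ e × e ⊆ cc j x × j ∈ e
  lam-edge {x} {j} ((e , e∈H , x∈ , e⊆) , ¬shorter) with j ∈? e
  ... | yes j∈ = e , e∈H , x∈ , e⊆ , j∈
  ... | no j∉ =
    ⊥-elim (¬shorter (e , e∈H , x∈ , λ y∈ → cc-shrinkˡ {j} (e⊆ y∈) (j∉ ∘ flip (subst (_∈ e)) y∈)))

  rho-edge : ∀ {x j} → IsRho H x j → ∃ λ e → H e × x ∈ e × e ⊆ cc x j × j ∈ e
  rho-edge {x} {j} ((e , e∈H , x∈ , e⊆) , ¬shorter) with j ∈? e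
  ... | yes j∈ = e , e∈H , x∈ , e⊆ , j∈
  ... | no j∉ =
    ⊥-elim (¬shorter (e , e∈H , x∈ , λ y∈ → cc-shrinkʳ {x} (e⊆ y∈) (j∉ ∘ flip (subst (_∈ e)) y∈)))

  lam-shortest : ∀ {x j j′} → IsLambda H x j → EdgeIn H x (cc j′ x) → δ (next x) j′ ≤ δ (next x) j
  lam-shortest {x} {j} {j′} (_ , ¬shorter) (h , h∈H , x∈ , h⊆) with δ (next x) j′ ≤? δ (next x) j
  ... | yes j′≤j = j′≤j
  ... | no j′≰j = ⊥-elim (¬shorter (h , h∈H , x∈ , shorten ∘ h⊆))
    where
    b = next x
    j<j′ : δ b j < δ b j′
    j<j′ = ≰⇒> j′≰j
    shorten : ∀ {z} → z ∈ cc j′ x → z ∈ cc (next j) x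
    shorten {z} z∈ with ∈-cc-from⁻ b (δ≤δ-next-self x j′) z∈
    ... | j′≤z , z≤x = ∈-cc-from⁺ b
      (subst (_≤ δ b z) (sym (δ-next-suc b j (<-≤-trans (s≤s j<j′) (δ<N b j′)))) (<-≤-trans j<j′ j′≤z))
      z≤x

  rho-shortest : ∀ {x j j′} → IsRho H x j → EdgeIn H x (cc x j′) → δ x j ≤ δ x j′
  rho-shortest {x} {j} {j′} (_ , ¬shorter) (h , h∈H , x∈ , h⊆) with δ x j ≤? δ x j′
  ... | yes j≤j′ = j≤j′
  ... | no j≰j′ = ⊥-elim (¬shorter (h , h∈H , x∈ , shorten ∘ h⊆))
    where
    j′<j : δ x j′ < δ x j
    j′<j = ≰⇒> j≰j′
    shorten : ∀ {z} → z ∈ cc x j′ → z ∈ cc x (prev j)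
    shorten {z} z∈ = ∈-cc-from⁺ x (δ-self≤ x z)
      (≤-trans (∈-cc⁻ z∈) (≤-pred (subst (δ x j′ <_) (sym (δ-prev-suc x j (≤-<-trans z≤n j′<j))) j′<j)))

  lam-unique : ∀ {x j j′} → IsLambda H x j → IsLambda H x j′ → j ≡ j′
  lam-unique {x} l l′ = δ-injective (next x) (≤-antisym (lam-shortest l′ (proj₁ l)) (lam-shortest l (proj₁ l′)))

module SaturatedHypergraph
  (m : ℕ) (1<N : 1 < suc m) (r : ℕ) (2≤r : 2 ≤ r) (2r≤N : 2 * r ≤ suc m)
  (H : Hypergraph (suc m)) (H? : Decidable H) (uniform : ∀ h → H h → ∣ h ∣ ≡ r)
  (saturated : Saturated r H) where

  open Cyclic m
  open NextPrev 1<N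
  open UniformHypergraph m 1<N r 2≤r H uniform

  no-copy : ∀ h₁ h₂ → H h₁ → H h₂ → ¬ FormCopy h₁ h₂
  no-copy = proj₁ saturated

  record Blocker (f : Subset N) (a : Fin N) : Set where
    constructor blocker
    field
      {edge} : Subset N
      edge∈H : H edge
      start end : Fin N
      edge⊆arc : edge ⊆ cc start end
      avoids : Avoids f (cc start end)
      a∈arc : a ∈ cc start end

  -- The blocking arc must contain a: otherwise e itself would form a copy with the blocking edge.
  exchange : ∀ {e a x} → H e → a ∈ e → x ∉ e → H (replace e a x) ⊎ Blocker (replace e a x) a
  exchange {e} {a} {x} e∈H a∈ x∉ with H? (replace e a x)
  ... | yes e′∈H = inj₁ e′∈H
  ... | no e′∉H with proj₂ saturated (replace e a x) (trans (∣replace∣ e a∈ x∉) (uniform e e∈H)) e′∉H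
  ...   | h , h∈H , copy with FormCopy⇒arc-separation h∈H copy
  ...     | s , t , h⊆ , avoids with a ∈? cc s t
  ...       | yes a∈arc = inj₂ (blocker h∈H s t h⊆ avoids a∈arc)
  ...       | no a∉arc = ⊥-elim (no-copy e h e∈H h∈H (arc-separation⇒FormCopy {e} {h} {s} {t} h∈H h⊆ e-avoids))
    where
    e-avoids : Avoids e (cc s t)
    e-avoids {y} y∈ with y ≟ᶠ a
    ... | yes refl = a∉arc
    ... | no y≢a = avoids (∈-replace-kept y∈ y≢a)

  EdgeIn? : ∀ v I → Dec (EdgeIn H v I)
  EdgeIn? v I = anySubset? (λ h → H? h ×-dec ((v ∈? h) ×-dec (h ⊆? I)))

  FitsIn : Subset N → Set
  FitsIn I = ∃ λ h → H h × h ⊆ I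

  FitsIn? : ∀ I → Dec (FitsIn I)
  FitsIn? I = anySubset? (λ h → H? h ×-dec (h ⊆? I))

  ∃-edge : ∃ λ h → H h
  ∃-edge with ∃-subset-of-size r (≤-trans (m≤n*m r 2) 2r≤N)
  ... | e , ∣e∣≡r with H? e
  ...   | yes e∈H = e , e∈H
  ...   | no e∉H with proj₂ saturated e ∣e∣≡r e∉H
  ...     | h , h∈H , _ = h , h∈H

  -- If v were in no edge, take an edge h in an arc [v+1, w] with w as close to v+1 as possible.
  -- Exchanging a vertex y ≠ w of h for v is blocked by an arc before w: a shorter such arc.
  module Uncovered (v : Fin N) (v∉ : ∀ h → H h → v ∉ h) where
    b : Fin N
    b = next v

    arc : ℕ → Subset N
    arc k = cc b (pt b k)

    ¬fits-0 : ¬ FitsIn (arc 0)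
    ¬fits-0 (h , h∈H , h⊆) = arc-of-edge-nondegenerate {h} {b} {b} h∈H h⊆ refl

    fits-m : FitsIn (arc m)
    fits-m with ∃-edge
    ... | h , h∈H = h , h∈H , λ {x} _ → subst (λ z → x ∈ cc b z) (sym (pt-next-m v)) (∈-cc-next-self v x)

    minimal-arc-absurd : ∀ k → k < m → ¬ FitsIn (arc k) → FitsIn (arc (suc k)) → ⊥
    minimal-arc-absurd k k<m ¬fits-k (h , h∈H , h⊆) with edge-∃-other h∈H (pt b (suc k))
    ... | y , y∈ , y≢w with exchange h∈H y∈ (v∉ h h∈H)
    ...   | inj₁ e′∈H = v∉ _ e′∈H ∈-replace-new
    ...   | inj₂ (blocker {h′} h′∈H s t h′⊆ avoids y∈arc) = ¬fits-k (h′ , h′∈H , before-w ∘ h′⊆)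
      where
      K<N : suc k < N
      K<N = s≤s k<m
      k<N : k < N
      k<N = <-trans (n<1+n k) K<N
      w = pt b (suc k)
      δ-w : δ b w ≡ suc k
      δ-w = δ-pt b (suc k) K<N
      below-w : ∀ {x} → x ∈ h → x ≢ w → δ b x ≤ k
      below-w {x} x∈ x≢w =
        ≤-pred (≤∧≢⇒< (∈-cc-pt⁻ b (suc k) K<N (h⊆ x∈)) (x≢w ∘ δ-injective b ∘ flip trans (sym δ-w)))
      w∈h : w ∈ h
      w∈h = decidable-stable (w ∈? h) λ w∉ →
        ¬fits-k (h , h∈H , λ x∈ → ∈-cc-pt⁺ b k k<N (below-w x∈ λ x≡w → w∉ (subst (_∈ h) x≡w x∈)))
      before-w : ∀ {x} → x ∈ cc s t → x ∈ arc k
      before-w {x} x∈ = ∈-cc-pt⁺ b k k<N (≤-pred (subst (δ b x <_) δ-w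
        (arc-below b (∉-cc⇒unwrapped-next v s t (avoids ∈-replace-new)) y∈arc
          (avoids (∈-replace-kept w∈h (y≢w ∘ sym))) (subst (δ b y <_) (sym δ-w) (s≤s (below-w y∈ y≢w))) x∈)))

    absurd : ⊥
    absurd with ∃-transition (¬_ ∘ FitsIn ∘ arc) (¬? ∘ FitsIn? ∘ arc) ¬fits-0 m (λ ¬fits → ¬fits fits-m)
    ... | k , k<m , ¬fits-k , ¬¬fits-k+1 =
      minimal-arc-absurd k k<m ¬fits-k (decidable-stable (FitsIn? (arc (suc k))) ¬¬fits-k+1)

  vertex-covered : ∀ v → ∃ λ h → H h × v ∈ h
  vertex-covered v with anySubset? (λ h → H? h ×-dec (v ∈? h))
  ... | yes covered = covered
  ... | no uncovered = ⊥-elim (Uncovered.absurd v (λ h h∈H v∈ → uncovered (h , h∈H , v∈)))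

  ∃-lam : ∀ i → ∃ λ j → IsLambda H i j
  ∃-lam i = lam-at (∃-transition reaches (EdgeIn? i ∘ arc) reaches-0 m ¬reaches-m)
    where
    arc : ℕ → Subset N
    arc k = cc (pt (next i) k) i
    reaches : ℕ → Set
    reaches k = EdgeIn H i (arc k)
    reaches-0 : reaches 0
    reaches-0 with vertex-covered i
    ... | h , h∈H , i∈ = h , h∈H , i∈ , λ {x} _ → ∈-cc-next-self i x
    ¬reaches-m : ¬ reaches m
    ¬reaches-m (h , h∈H , _ , h⊆) = arc-of-edge-nondegenerate {h} {pt (next i) m} {i} h∈H h⊆ (pt-next-m i)
    lam-at : (∃ λ k → k < m × reaches k × ¬ reaches (suc k)) → ∃ λ j → IsLambda H i j
    lam-at (k , _ , reaches-k , ¬reaches-k+1) = pt (next i) k , reaches-k , ¬reaches-k+1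

  ∃-rho : ∀ i → ∃ λ j → IsRho H i j
  ∃-rho i =
    rho-at (∃-transition (¬_ ∘ reaches) (¬? ∘ EdgeIn? i ∘ arc) ¬reaches-0 m (λ ¬reaches → ¬reaches reaches-m))
    where
    arc : ℕ → Subset N
    arc k = cc i (pt i k)
    reaches : ℕ → Set
    reaches k = EdgeIn H i (arc k)
    ¬reaches-0 : ¬ reaches 0
    ¬reaches-0 (h , h∈H , _ , h⊆) = arc-of-edge-nondegenerate {h} {i} {i} h∈H h⊆ refl
    reaches-m : reaches m
    reaches-m with vertex-covered i
    ... | h , h∈H , i∈ = h , h∈H , i∈ , λ {x} _ → subst (λ z → x ∈ cc i z) (sym (pt-m i)) (∈-cc-prev i x)
    rho-at : (∃ λ k → k < m × ¬ reaches k × ¬ ¬ reaches (suc k)) → ∃ λ j → IsRho H i j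
    rho-at (k , _ , ¬reaches-k , ¬¬reaches-k+1) =
      pt i (suc k) , decidable-stable (EdgeIn? i (arc (suc k))) ¬¬reaches-k+1 ,
      ¬reaches-k ∘ subst (λ z → EdgeIn H i (cc i z)) (prev-next (pt i k))

  -- If a = λ(v) and b = ρ(v+1) were distinct, then v+1 ≤ a < b ≤ v and the arcs [v+1, a] and
  -- [b, v] cannot both contain edges.  Exchanging a (resp. b) in its witness edge shows that if one
  -- of them contains no edge, the witness edge of the other side fills its whole arc; and two
  -- filled arcs would give 2r ≥ n + 2.
  module RhoNextLam
    (v a b : Fin N)
    (¬shorter-a : ¬ EdgeIn H v (cc (next a) v)) (¬shorter-b : ¬ EdgeIn H (next v) (cc (next v) (prev b)))
    {e : Subset N} (e∈H : H e) (v∈e : v ∈ e) (e⊆ : e ⊆ cc a v) (a∈e : a ∈ e)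
    {g : Subset N} (g∈H : H g) (u∈g : next v ∈ g) (g⊆ : g ⊆ cc (next v) b) (b∈g : b ∈ g)
    (a≢v : a ≢ v) (b≢u : b ≢ next v) (b≢a : b ≢ a) where

    u a⁺ b⁻ : Fin N
    u = next v
    a⁺ = next a
    b⁻ = prev b

    ≤v : ∀ y → δ u y ≤ δ u v
    ≤v = δ≤δ-next-self v

    ∈[_,v] : ∀ {p y} → δ u p ≤ δ u y → y ∈ cc p v
    ∈[_,v] {p} le = ∈-cc-from⁺ u le (≤v _)

    ∈[u,_] : ∀ {q y} → δ u y ≤ δ u q → y ∈ cc u q
    ∈[u,_] {q} le = ∈-cc⁺ {u} {q} le

    [_,v]∋⇒ : ∀ {p y} → y ∈ cc p v → δ u p ≤ δ u y
    [_,v]∋⇒ {p} y∈ = proj₁ (∈-cc-from⁻ u (≤v p) y∈)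

    a<b : δ u a < δ u b
    a<b with δ u a <? δ u b
    ... | yes a<b = a<b
    ... | no a≮b = ⊥-elim (no-copy e g e∈H g∈H (arc-separation⇒FormCopy {e} {g} {u} {b} g∈H g⊆ e-avoids))
      where
      b<a : δ u b < δ u a
      b<a = ≤∧≢⇒< (≮⇒≥ a≮b) (b≢a ∘ δ-injective u)
      e-avoids : Avoids e (cc u b)
      e-avoids y∈ y∈arc = <⇒≱ b<a (≤-trans ([_,v]∋⇒ {a} (e⊆ y∈)) (∈-cc⁻ y∈arc))

    δ-a⁺ : δ u a⁺ ≡ suc (δ u a)
    δ-a⁺ = δ-next-suc u a (<-≤-trans (s≤s a<b) (δ<N u b))

    δ-b⁻ : suc (δ u b⁻) ≡ δ u b
    δ-b⁻ = δ-prev-suc u b (≤-<-trans z≤n a<b)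

    ¬both-sides : FitsIn (cc u a) → FitsIn (cc b v) → ⊥
    ¬both-sides (f₁ , f₁∈H , f₁⊆) (f₂ , f₂∈H , f₂⊆) =
      no-copy f₂ f₁ f₂∈H f₁∈H (arc-separation⇒FormCopy {f₂} {f₁} {u} {a} f₁∈H f₁⊆ f₂-avoids)
      where
      f₂-avoids : Avoids f₂ (cc u a)
      f₂-avoids y∈ y∈arc = <⇒≱ a<b (≤-trans ([_,v]∋⇒ {b} (f₂⊆ y∈)) (∈-cc⁻ y∈arc))

    left-exchange-absurd : ¬ FitsIn (cc u a) → ∀ {x} → x ∉ e → x ∈ cc a⁺ v → a⁺ ∈ replace e a x → ⊥
    left-exchange-absurd ¬fits {x} x∉ x∈ a⁺∈ with exchange e∈H a∈e x∉
    ... | inj₁ e′∈H = ¬shorter-a (replace e a x , e′∈H , ∈-replace-kept v∈e (a≢v ∘ sym) , e′⊆)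
      where
      e′⊆ : replace e a x ⊆ cc a⁺ v
      e′⊆ y∈ with ∈-replace⁻ y∈
      ... | inj₁ (y∈e , y≢a) = cc-shrinkˡ {a} (e⊆ y∈e) y≢a
      ... | inj₂ refl = x∈
    ... | inj₂ (blocker {h} h∈H s t h⊆ avoids a∈arc) = ¬fits (h , h∈H , ∈[u,_] {a} ∘ below-a⁺ ∘ h⊆)
      where
      below-a⁺ : ∀ {y} → y ∈ cc s t → δ u y ≤ δ u a
      below-a⁺ {y} y∈ = ≤-pred (subst (δ u y <_) δ-a⁺
        (arc-below u (∉-cc⇒unwrapped-next v s t (avoids (∈-replace-kept v∈e (a≢v ∘ sym))))
          a∈arc (avoids a⁺∈) (subst (δ u a <_) (sym δ-a⁺) ≤-refl) y∈))

    left-filled : ¬ FitsIn (cc u a) → ∀ {x} → x ∈ cc a⁺ v → x ∈ e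
    left-filled ¬fits {x} x∈ = decidable-stable (x ∈? e) λ x∉ → case a⁺ ∈? e of λ where
      (yes a⁺∈e) → left-exchange-absurd ¬fits x∉ x∈ (∈-replace-kept a⁺∈e (next≢ a))
      (no a⁺∉e) → left-exchange-absurd ¬fits a⁺∉e (∈-cc-self a⁺ v) ∈-replace-new

    right-exchange-absurd : ¬ FitsIn (cc b v) → ∀ {y} → y ∉ g → y ∈ cc u b⁻ → b⁻ ∈ replace g b y → ⊥
    right-exchange-absurd ¬fits {y} y∉ y∈ b⁻∈ with exchange g∈H b∈g y∉
    ... | inj₁ g′∈H = ¬shorter-b (replace g b y , g′∈H , ∈-replace-kept u∈g (b≢u ∘ sym) , g′⊆)
      where
      g′⊆ : replace g b y ⊆ cc u b⁻
      g′⊆ z∈ with ∈-replace⁻ z∈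
      ... | inj₁ (z∈g , z≢b) = cc-shrinkʳ {u} (g⊆ z∈g) z≢b
      ... | inj₂ refl = y∈
    ... | inj₂ (blocker {h} h∈H s t h⊆ avoids b∈arc) = ¬fits (h , h∈H , ∈[_,v] {b} ∘ above-b⁻ ∘ h⊆)
      where
      above-b⁻ : ∀ {z} → z ∈ cc s t → δ u b ≤ δ u z
      above-b⁻ {z} z∈ = subst (_≤ δ u z) δ-b⁻
        (arc-above u (∉-cc⇒unwrapped u s t (avoids (∈-replace-kept u∈g (b≢u ∘ sym))))
          b∈arc (avoids b⁻∈) (subst (δ u b⁻ <_) δ-b⁻ ≤-refl) z∈)

    right-filled : ¬ FitsIn (cc b v) → ∀ {y} → y ∈ cc u b⁻ → y ∈ g
    right-filled ¬fits {y} y∈ = decidable-stable (y ∈? g) λ y∉ → case b⁻ ∈? g of λ where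
      (yes b⁻∈g) → right-exchange-absurd ¬fits y∉ y∈ (∈-replace-kept b⁻∈g (prev≢ b))
      (no b⁻∉g) → right-exchange-absurd ¬fits b⁻∉g (∈-cc-end u b⁻) ∈-replace-new

    -- an edge inside a filled arc would be a proper subset of an edge
    left-filled⇒¬fits-right : (∀ {x} → x ∈ cc a⁺ v → x ∈ e) → ¬ FitsIn (cc b v)
    left-filled⇒¬fits-right filled (f , f∈H , f⊆) =
      <-irrefl (trans (uniform f f∈H) (sym (uniform e e∈H))) (p⊂q⇒∣p∣<∣q∣ (f⊆e , a , a∈e , a∉f))
      where
      f⊆e : f ⊆ e
      f⊆e {y} y∈ = filled (∈[_,v] {a⁺}
        (subst (_≤ δ u y) (sym δ-a⁺) (<-≤-trans a<b ([_,v]∋⇒ {b} (f⊆ y∈)))))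
      a∉f : a ∉ f
      a∉f a∈ = <⇒≱ a<b ([_,v]∋⇒ {b} (f⊆ a∈))

    right-filled⇒¬fits-left : (∀ {y} → y ∈ cc u b⁻ → y ∈ g) → ¬ FitsIn (cc u a)
    right-filled⇒¬fits-left filled (f , f∈H , f⊆) =
      <-irrefl (trans (uniform f f∈H) (sym (uniform g g∈H))) (p⊂q⇒∣p∣<∣q∣ (f⊆g , b , b∈g , b∉f))
      where
      f⊆g : f ⊆ g
      f⊆g {y} y∈ = filled (∈[u,_] {b⁻}
        (≤-pred (subst (δ u y <_) (sym δ-b⁻) (≤-<-trans (∈-cc⁻ {u} {a} (f⊆ y∈)) a<b))))
      b∉f : b ∉ f
      b∉f b∈ = <⇒≱ a<b (∈-cc⁻ {u} {a} (f⊆ b∈))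

    both-filled-absurd : (∀ {x} → x ∈ cc a⁺ v → x ∈ e) → (∀ {y} → y ∈ cc u b⁻ → y ∈ g) → ⊥
    both-filled-absurd e-filled g-filled =
      <⇒≱ (≤-trans N<N+2 (+-mono-≤ ∣g∪e∣≥N ∣g∩e∣≥2)) (subst (_≤ N) 2r≡ 2r≤N)
      where
      N<N+2 : N < N + 2
      N<N+2 = m<m+n N (s≤s z≤n)
      covered : ∀ x → x ∈ g ∪ e
      covered x with δ u x ≤? δ u b⁻
      ... | yes x≤b⁻ = x∈p∪q⁺ (inj₁ (g-filled (∈[u,_] {b⁻} x≤b⁻)))
      ... | no x≰b⁻ = x∈p∪q⁺ (inj₂ (e-filled (∈[_,v] {a⁺} (subst (_≤ δ u x) (sym δ-a⁺)
              (≤-trans a<b (subst (_≤ δ u x) δ-b⁻ (≰⇒> x≰b⁻)))))))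
      ∣g∪e∣≥N : N ≤ ∣ g ∪ e ∣
      ∣g∪e∣≥N = subst (_≤ ∣ g ∪ e ∣) (∣⊤∣≡n N) (p⊆q⇒∣p∣≤∣q∣ {p = ⊤} (λ {x} _ → covered x))
      ∣g∩e∣≥2 : 2 ≤ ∣ g ∩ e ∣
      ∣g∩e∣≥2 = ∈∧∈∧≢⇒2≤∣p∣
        (x∈p∩q⁺ (g-filled (∈[u,_] {b⁻} (≤-pred (subst (δ u a <_) (sym δ-b⁻) a<b))) , a∈e))
        (x∈p∩q⁺ (b∈g , e-filled (∈[_,v] {a⁺} (subst (_≤ δ u b) (sym δ-a⁺) a<b)))) (b≢a ∘ sym)
      2r≡ : 2 * r ≡ ∣ g ∪ e ∣ + ∣ g ∩ e ∣
      2r≡ = sym (trans (∣p∪q∣+∣p∩q∣ g e)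
        (trans (cong₂ _+_ (uniform g g∈H) (uniform e e∈H)) (cong (r +_) (sym (+-identityʳ r)))))

    absurd : ⊥
    absurd with FitsIn? (cc u a)
    ... | yes fits-left = right-filled⇒¬fits-left (right-filled (¬both-sides fits-left)) fits-left
    ... | no ¬fits-left = both-filled-absurd (left-filled ¬fits-left)
                            (right-filled (left-filled⇒¬fits-right (left-filled ¬fits-left)))

  rho-next≡lam : ∀ {v a b} → IsLambda H v a → IsRho H (next v) b → b ≡ a
  rho-next≡lam {v} {a} {b} lam-v rho-u with b ≟ᶠ a
  ... | yes b≡a = b≡a
  ... | no b≢a with lam-edge lam-v | rho-edge rho-u
  ...   | _ , e∈H , v∈e , e⊆ , a∈e | _ , g∈H , u∈g , g⊆ , b∈g =
    ⊥-elim (RhoNextLam.absurd v a b (proj₂ lam-v) (proj₂ rho-u) e∈H v∈e e⊆ a∈e g∈H u∈g g⊆ b∈g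
              (lam≢ lam-v) (rho≢ rho-u) b≢a)

  -- Exchanging p for p+1 in the witness edge of λ(p) = c yields an edge through p+1 inside
  -- [c, p+1]; a blocking arc would either give a shorter arc for λ(p) or separate the witness edge.
  module LamArcExtends
    (p c : Fin N) (¬shorter : ¬ EdgeIn H p (cc (next c) p))
    {e : Subset N} (e∈H : H e) (p∈e : p ∈ e) (e⊆ : e ⊆ cc c p) (c∈e : c ∈ e)
    (c≢p : c ≢ p) (c≢i : c ≢ next p) where

    i c⁺ : Fin N
    i = next p
    c⁺ = next c

    δ-i : δ c i ≡ suc (δ c p)
    δ-i with suc (δ c p) <? N
    ... | yes lt = δ-next-suc c p lt
    ... | no ≮ = ⊥-elim (c≢i (sym (next-δ≡N c p (≤-antisym (δ<N c p) (≮⇒≥ ≮)))))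

    δ-c⁺-i : δ c⁺ i ≡ suc (δ c⁺ p)
    δ-c⁺-i = δ-next-suc c⁺ p
      (s≤s (≤∧≢⇒< (≤-pred (δ<N c⁺ p)) (c≢p ∘ δ-injective c⁺ ∘ trans (δ-next-self c) ∘ sym)))

    i∉e : i ∉ e
    i∉e i∈ = <-irrefl refl (<-≤-trans (subst (δ c p <_) (sym δ-i) ≤-refl) (∈-cc⁻ (e⊆ i∈)))

    e′⊆ : replace e p i ⊆ cc c i
    e′⊆ z∈ with ∈-replace⁻ z∈
    ... | inj₁ (z∈e , _) =
      ∈-cc⁺ {c} {i} (≤-trans (∈-cc⁻ (e⊆ z∈e)) (subst (δ c p ≤_) (sym δ-i) (n≤1+n _)))
    ... | inj₂ refl = ∈-cc-end c i

    module Blocked {h : Subset N} (h∈H : H h) (s t : Fin N) (h⊆ : h ⊆ cc s t)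
                   (avoids : Avoids (replace e p i) (cc s t)) (p∈arc : p ∈ cc s t) where

      unwrapped : δ c⁺ s ≤ δ c⁺ t
      unwrapped = ∉-cc⇒unwrapped-next c s t (avoids (∈-replace-kept c∈e c≢p))

      ≤p : ∀ {x} → x ∈ cc s t → δ c⁺ x ≤ δ c⁺ p
      ≤p {x} x∈ = ≤-pred (subst (δ c⁺ x <_) δ-c⁺-i
        (arc-below c⁺ unwrapped p∈arc (avoids ∈-replace-new) (subst (δ c⁺ p <_) (sym δ-c⁺-i) ≤-refl) x∈))

      absurd : ⊥
      absurd with p ∈? h
      ... | yes p∈h = ¬shorter (h , h∈H , p∈h , λ x∈ → ∈-cc⁺ {c⁺} {p} (≤p (h⊆ x∈)))
      ... | no p∉h = no-copy e h e∈H h∈H (arc-separation⇒FormCopy {e} {h} {s} {prev p} h∈H h⊆′ e-avoids)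
        where
        <p : ∀ {x} → x ∈ h → δ c⁺ x < δ c⁺ p
        <p {x} x∈ = ≤∧≢⇒< (≤p (h⊆ x∈)) (λ eq → p∉h (subst (_∈ h) (δ-injective c⁺ eq) x∈))
        x₀ : Fin N
        x₀ = proj₁ (edge-nonempty h∈H)
        x₀∈ : x₀ ∈ h
        x₀∈ = proj₂ (edge-nonempty h∈H)
        δ-p⁻ : suc (δ c⁺ (prev p)) ≡ δ c⁺ p
        δ-p⁻ = δ-prev-suc c⁺ p (≤-<-trans z≤n (<p x₀∈))
        ≤p⁻ : ∀ {x} → x ∈ h → δ c⁺ x ≤ δ c⁺ (prev p)
        ≤p⁻ {x} x∈ = ≤-pred (subst (δ c⁺ x <_) (sym δ-p⁻) (<p x∈))
        s≤p⁻ : δ c⁺ s ≤ δ c⁺ (prev p)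
        s≤p⁻ = ≤-trans (proj₁ (∈-cc-from⁻ c⁺ unwrapped (h⊆ x₀∈))) (≤p⁻ x₀∈)
        h⊆′ : h ⊆ cc s (prev p)
        h⊆′ x∈ = ∈-cc-from⁺ c⁺ (proj₁ (∈-cc-from⁻ c⁺ unwrapped (h⊆ x∈))) (≤p⁻ x∈)
        e-avoids : Avoids e (cc s (prev p))
        e-avoids {y} y∈ y∈arc =
          avoids (∈-replace-kept y∈ y≢p) (∈-cc-from⁺ c⁺ s≤y (≤-trans (<⇒≤ y<p) p≤t))
          where
          s≤y = proj₁ (∈-cc-from⁻ c⁺ s≤p⁻ y∈arc)
          y<p : δ c⁺ y < δ c⁺ p
          y<p = subst (δ c⁺ y <_) δ-p⁻ (s≤s (proj₂ (∈-cc-from⁻ c⁺ s≤p⁻ y∈arc)))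
          y≢p : y ≢ p
          y≢p y≡p = <-irrefl (cong (δ c⁺) y≡p) y<p
          p≤t = proj₂ (∈-cc-from⁻ c⁺ unwrapped p∈arc)

    edge-through-i : EdgeIn H i (cc c i)
    edge-through-i with exchange e∈H p∈e i∉e
    ... | inj₁ e′∈H = replace e p i , e′∈H , ∈-replace-new , e′⊆
    ... | inj₂ (blocker h∈H s t h⊆ avoids p∈arc) = ⊥-elim (Blocked.absurd h∈H s t h⊆ avoids p∈arc)

  lam-monotone : ∀ {p c d} → IsLambda H p c → c ≢ next p → IsLambda H (next p) d → δ c d < δ c (next p)
  lam-monotone {p} {c} {d} lam-p c≢i lam-i with lam-edge lam-p
  ... | e , e∈H , p∈e , e⊆ , c∈e = δ-rebase-< B c≤d (δ≤δ-next-self i c) d<i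
    where
    i = next p
    B = next i
    c≤d : δ B c ≤ δ B d
    c≤d = lam-shortest lam-i (LamArcExtends.edge-through-i p c (proj₂ lam-p) e∈H p∈e e⊆ c∈e (lam≢ lam-p) c≢i)
    d<i : δ B d < δ B i
    d<i = ≤∧≢⇒< (δ≤δ-next-self i d) (lam≢ lam-i ∘ δ-injective B)

  lam-prev-monotone : ∀ {i c d} → IsLambda H (prev i) c → IsRho H i c → IsLambda H i d → δ c d < δ c i
  lam-prev-monotone {i} {c} {d} lam-i⁻ rho-i lam-i = subst (λ z → δ c d < δ c z) (next-prev i)
    (lam-monotone lam-i⁻ (rho≢ rho-i ∘ flip trans (next-prev i))
      (subst (λ z → IsLambda H z d) (sym (next-prev i)) lam-i))

  lam-of-rho : ∀ {i c d} → IsLambda H (prev i) c → IsRho H i c → IsLambda H i d → d ≢ c → IsLambda H c i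
  lam-of-rho {i} {c} {d} lam-i⁻ rho-i lam-i d≢c with rho-edge rho-i | lam-edge lam-i
  ... | g , g∈H , _ , g⊆ , c∈g | f , f∈H , _ , f⊆ , _ = (g , g∈H , c∈g , g⊆) , ¬shorter
    where
    B = next i
    c<d : δ B c < δ B d
    c<d with δ-split B c d
    ... | inj₁ (c≤d , _) = ≤∧≢⇒< c≤d (d≢c ∘ δ-injective B ∘ sym)
    ... | inj₂ (_ , wraps) = ⊥-elim (m+n≮n (δ B d) N (<-trans
            (subst₂ _<_ wraps (δ-additive B c i (δ≤δ-next-self i c))
              (+-monoʳ-< (δ B c) (lam-prev-monotone lam-i⁻ rho-i lam-i)))
            (δ<N B i)))
    f-avoids : Avoids f (cc B c)
    f-avoids y∈ y∈arc =
      <⇒≱ c<d (≤-trans (proj₁ (∈-cc-from⁻ B (δ≤δ-next-self i d) (f⊆ y∈))) (∈-cc⁻ y∈arc))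
    ¬shorter : ¬ EdgeIn H c (cc B c)
    ¬shorter (h , h∈H , _ , h⊆) = no-copy f h f∈H h∈H (arc-separation⇒FormCopy {f} {h} {B} {c} h∈H h⊆ f-avoids)

  rho-of-rho : ∀ {i c d x} → IsLambda H (prev i) c → IsRho H i c → IsLambda H i d → IsRho H c x → x ∈ co d i
  rho-of-rho {i} {c} {d} {x} lam-i⁻ rho-i lam-i rho-c with lam-edge lam-i⁻ | lam-edge lam-i
  ... | e , e∈H , _ , e⊆ , c∈e | f , f∈H , _ , f⊆ , _ = ∈-co⁺ (δ-rebase-< c d≤x (<⇒≤ d<i) x<i)
    where
    d<i : δ c d < δ c i
    d<i = lam-prev-monotone lam-i⁻ rho-i lam-i
    x<i : δ c x < δ c i
    x<i = subst (δ c x <_) (δ-prev-suc c i (δ-pos (rho≢ rho-i))) (s≤s (rho-shortest rho-c (e , e∈H , c∈e , e⊆)))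
    d≤x : δ c d ≤ δ c x
    d≤x with δ c d ≤? δ c x | proj₁ rho-c
    ... | yes d≤x | _ = d≤x
    ... | no d≰x | h , h∈H , _ , h⊆ =
      ⊥-elim (no-copy f h f∈H h∈H (arc-separation⇒FormCopy {f} {h} {c} {x} h∈H h⊆ f-avoids))
      where
      f-avoids : Avoids f (cc c x)
      f-avoids y∈ y∈arc = d≰x (≤-trans (proj₁ (∈-cc-from⁻ c (<⇒≤ d<i) (f⊆ y∈))) (∈-cc⁻ y∈arc))

  module Intervals (lam rho : Fin N → Fin N)
                   (lam-spec : ∀ i → IsLambda H i (lam i)) (rho-spec : ∀ i → IsRho H i (rho i)) where

    lam-prev≡rho : ∀ i → lam (prev i) ≡ rho i
    lam-prev≡rho i =
      sym (rho-next≡lam (lam-spec (prev i)) (subst (λ z → IsRho H z (rho i)) (sym (next-prev i)) (rho-spec i)))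

    lam-prev-spec : ∀ i → IsLambda H (prev i) (rho i)
    lam-prev-spec i = subst (IsLambda H (prev i)) (lam-prev≡rho i) (lam-spec (prev i))

    len : Fin N → ℕ
    len i = δ (rho i) (lam i)

    len<δ : ∀ i → len i < δ (rho i) i
    len<δ i = lam-prev-monotone (lam-prev-spec i) (rho-spec i) (lam-spec i)

    gap : Fin N → ℕ
    gap i = δ (lam i) i

    telescope : ∀ i → len i + gap i ≡ gap (prev i) + 1
    telescope i = begin
      len i + gap i                ≡⟨ δ-additive (rho i) (lam i) i (<⇒≤ (len<δ i)) ⟩
      δ (rho i) i                  ≡⟨ δ-prev-suc (rho i) i (δ-pos (rho≢ (rho-spec i))) ⟨
      suc (δ (rho i) (prev i))     ≡⟨ cong (λ z → suc (δ z (prev i))) (lam-prev≡rho i) ⟨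
      suc (gap (prev i))           ≡⟨ +-comm 1 _ ⟩
      gap (prev i) + 1             ∎
      where open ≡-Reasoning

    sum-len : sum len ≡ N
    sum-len = +-cancelʳ-≡ (sum gap) _ _ (begin
      sum len + sum gap                     ≡⟨ ∑-distrib-+ len gap ⟨
      sum (λ i → len i + gap i)             ≡⟨ sum-cong-≗ telescope ⟩
      sum (λ i → gap (prev i) + 1)          ≡⟨ ∑-distrib-+ (gap ∘ prev) (λ _ → 1) ⟩
      sum (gap ∘ prev) + sum {N} (λ _ → 1)  ≡⟨ cong₂ _+_ (sum-∘prev gap) (sum-const-1 N) ⟩
      sum gap + N                           ≡⟨ +-comm (sum gap) N ⟩
      N + sum gap                           ∎)
      where open ≡-Reasoning

    Covers : Fin N → Fin N → Set
    Covers i w = δ (rho i) w < len i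

    covers-count : Fin N → Fin N → ℕ
    covers-count w i = indicator (δ (rho i) w <? len i)

    -- going from rho i to w directly or via lam i differs by one full turn exactly when i covers w
    covers-via-lam : ∀ w i → len i + δ (lam i) w ≡ δ (rho i) w + N * covers-count w i
    covers-via-lam w i with δ (rho i) w <? len i | δ-triangle (rho i) (lam i) w
    ... | yes w<lam | inj₁ eq = ⊥-elim (<⇒≱ w<lam (subst (len i ≤_) eq (m≤m+n (len i) _)))
    ... | yes _ | inj₂ eq = trans eq (cong (δ (rho i) w +_) (sym (*-identityʳ N)))
    ... | no _ | inj₁ eq = trans eq (sym (trans (cong (δ (rho i) w +_) (*-zeroʳ N)) (+-identityʳ _)))
    ... | no w≮lam | inj₂ eq = ⊥-elim (<⇒≱ (δ<N (lam i) w)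
            (+-cancelˡ-≤ (δ (rho i) w) N _
              (subst (_≤ δ (rho i) w + δ (lam i) w) eq (+-monoˡ-≤ (δ (lam i) w) (≮⇒≥ w≮lam)))))

    sum-covers-count : ∀ w → sum (covers-count w) ≡ 1
    sum-covers-count w = *-cancelˡ-≡ _ _ N (sym (trans (*-identityʳ N) (+-cancelˡ-≡ (sum Δ) _ _ both-ways)))
      where
      open ≡-Reasoning
      count = covers-count w
      Δ : Fin N → ℕ
      Δ i = δ (lam i) w
      via-lam : ∀ i → len i + Δ i ≡ Δ (prev i) + N * count i
      via-lam i = trans (covers-via-lam w i) (cong (λ z → δ z w + N * count i) (sym (lam-prev≡rho i)))
      both-ways : sum Δ + N ≡ sum Δ + N * sum count
      both-ways = begin
        sum Δ + N                                ≡⟨ +-comm (sum Δ) N ⟩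
        N + sum Δ                                ≡⟨ cong (_+ sum Δ) sum-len ⟨
        sum len + sum Δ                          ≡⟨ ∑-distrib-+ len Δ ⟨
        sum (λ i → len i + Δ i)                  ≡⟨ sum-cong-≗ via-lam ⟩
        sum (λ i → Δ (prev i) + N * count i)     ≡⟨ ∑-distrib-+ (Δ ∘ prev) (λ i → N * count i) ⟩
        sum (Δ ∘ prev) + sum (λ i → N * count i) ≡⟨ cong₂ _+_ (sum-∘prev Δ) (sym (*-distribˡ-sum N count)) ⟩
        sum Δ + N * sum count                    ∎

    covered : ∀ w → ∃ λ i → Covers i w
    covered w with any? (λ i → δ (rho i) w <? len i)
    ... | yes covering = covering
    ... | no ¬covering =
      ⊥-elim (0≢1+n (trans (sym (trans (sum-cong-≗ uncounted) (sum-replicate-zero N))) (sum-covers-count w)))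
      where
      uncounted : ∀ i → covers-count w i ≡ 0
      uncounted i with δ (rho i) w <? len i
      ... | yes covers = ⊥-elim (¬covering (i , covers))
      ... | no _ = refl

    covered-once : ∀ {w i j} → Covers i w → Covers j w → i ≡ j
    covered-once {w} {i} {j} covers-i covers-j with i ≟ᶠ j
    ... | yes i≡j = i≡j
    ... | no i≢j = ⊥-elim (<⇒≱ (s≤s ≤-refl)
                    (subst₂ _≤_ (cong₂ _+_ (counted covers-i) (counted covers-j)) (sum-covers-count w)
                      (two-terms≤sum (covers-count w) i j i≢j)))
      where
      counted : ∀ {k} → Covers k w → covers-count w k ≡ 1
      counted {k} covers with δ (rho k) w <? len k
      ... | yes _ = refl
      ... | no ¬covers = ⊥-elim (¬covers covers)

    I : Fin N → Subset N
    I i = cc (rho i) (lam i)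

    ∈I⇒covers⊎≡lam : ∀ {i z} → z ∈ I i → Covers i z ⊎ z ≡ lam i
    ∈I⇒covers⊎≡lam {i} {z} z∈ with m≤n⇒m<n∨m≡n (∈-cc⁻ z∈)
    ... | inj₁ covers = inj₁ covers
    ... | inj₂ eq = inj₂ (δ-injective (rho i) eq)

    len+1<N : ∀ i → suc (len i) < N
    len+1<N i = <-≤-trans (s≤s (len<δ i)) (δ<N (rho i) i)

    covers⇒next∈I : ∀ {i j} → Covers i j → next j ∈ I i
    covers⇒next∈I {i} {j} covers = ∈-cc⁺ {rho i} {lam i}
      (subst (_≤ len i) (sym (δ-next-suc (rho i) j (<-trans (s≤s covers) (len+1<N i)))) covers)

    next-lam∉I : ∀ i → next (lam i) ∉ I i
    next-lam∉I i next∈ = <⇒≱ (subst (len i <_) (sym (δ-next-suc (rho i) (lam i) (len+1<N i))) ≤-refl) (∈-cc⁻ next∈)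

    consecutive-in-unique-interval : ∀ j → ∃ λ i → (j ∈ I i × next j ∈ I i) ×
                                                  (∀ i′ → j ∈ I i′ → next j ∈ I i′ → I i′ ≡ I i)
    consecutive-in-unique-interval j with covered j
    ... | i , covers = i , (∈-cc⁺ {rho i} {lam i} (<⇒≤ covers) , covers⇒next∈I covers) , unique
      where
      unique : ∀ i′ → j ∈ I i′ → next j ∈ I i′ → I i′ ≡ I i
      unique i′ j∈ next∈ with ∈I⇒covers⊎≡lam j∈
      ... | inj₁ covers′ = cong I (covered-once covers′ covers)
      ... | inj₂ refl = ⊥-elim (next-lam∉I i′ next∈)

    rho∘next≡lam : ∀ i → rho (next i) ≡ lam i
    rho∘next≡lam i = rho-next≡lam (lam-spec i) (rho-spec (next i))

    rho∘rho∈ : ∀ i → rho (rho i) ∈ co (lam i) i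
    rho∘rho∈ i = rho-of-rho (lam-prev-spec i) (rho-spec i) (lam-spec i) (rho-spec (rho i))

    lam-rho : ∀ i → lam i ≢ rho i → lam (rho i) ≡ i
    lam-rho i lam≢rho = lam-unique (lam-spec (rho i)) (lam-of-rho (lam-prev-spec i) (rho-spec i) (lam-spec i) lam≢rho)

    0<len⇒lam≢rho : ∀ {i} → 0 < len i → lam i ≢ rho i
    0<len⇒lam≢rho {i} pos eq = <-irrefl (sym (trans (cong (δ (rho i)) eq) (δ-self (rho i)))) pos

    -- If the right ends of two intervals lie in each other's half-open interval, these two cover
    -- the whole circle, so every other interval is a single point, i.e. λ is constant between them:
    -- then λ(i - 1) would be λ(i) or λ(j) = i, both impossible.
    module MutuallyCovering (i j : Fin N) (lam-i∈ : Covers j (lam i)) (lam-j∈ : Covers i (lam j))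
                            (lam-i≢lam-j : lam i ≢ lam j) where

      covers-i⊎j : ∀ z → Covers i z ⊎ Covers j z
      covers-i⊎j z with δ (lam j) z <? δ (lam j) (lam i)
      ... | yes z<lam-i = inj₁ (δ-suffix-< lam-j∈ z<lam-i)
      ... | no z≮lam-i = inj₂ (δ-suffix-< lam-i∈ (δ-complement-< lam-i≢lam-j (≮⇒≥ z≮lam-i)))

      0<len : ∀ {k w} → Covers k w → 0 < len k
      0<len covers = ≤-<-trans z≤n covers

      len≡0 : ∀ k → k ≢ i → k ≢ j → len k ≡ 0
      len≡0 k k≢i k≢j with len k in eq
      ... | zero = refl
      ... | suc _ =
        ⊥-elim ([ k≢i ∘ covered-once covers-k , k≢j ∘ covered-once covers-k ]′ (covers-i⊎j (rho k)))
        where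
        covers-k : Covers k (rho k)
        covers-k = subst₂ _<_ (sym (δ-self (rho k))) (sym eq) (s≤s z≤n)

      lam-two-valued : ∀ k → lam k ≡ lam i ⊎ lam k ≡ lam j
      lam-two-valued k = walk (δ i k) k refl
        where
        walk : ∀ t k → δ i k ≡ t → lam k ≡ lam i ⊎ lam k ≡ lam j
        walk zero k eq = inj₁ (cong lam (sym (δ≡0⇒≡ i eq)))
        walk (suc t) k eq with k ≟ᶠ j
        ... | yes refl = inj₂ refl
        ... | no k≢j = Sum.map (trans lam≡lam-prev) (trans lam≡lam-prev)
                         (walk t (prev k) (suc-injective (trans (δ-prev-suc i k (subst (0 <_) (sym eq) (s≤s z≤n))) eq)))
          where
          k≢i : k ≢ i
          k≢i refl = 0≢1+n (trans (sym (δ-self i)) eq)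
          lam≡lam-prev : lam k ≡ lam (prev k)
          lam≡lam-prev = trans (sym (δ≡0⇒≡ (rho k) (len≡0 k k≢i k≢j))) (sym (lam-prev≡rho k))

      i≡lam-j : i ≡ lam j
      i≡lam-j with lam-two-valued (rho i) | lam-rho i (0<len⇒lam≢rho (0<len lam-j∈))
      ... | inj₁ eq | lam-rho≡i = ⊥-elim (lam≢ (lam-spec i) (trans (sym eq) lam-rho≡i))
      ... | inj₂ eq | lam-rho≡i = trans (sym lam-rho≡i) eq

      absurd : ⊥
      absurd with lam-two-valued (prev i)
      ... | inj₁ lam-prev≡lam-i = 0<len⇒lam≢rho (0<len lam-j∈) (trans (sym lam-prev≡lam-i) (lam-prev≡rho i))
      ... | inj₂ lam-prev≡lam-j = rho≢ (rho-spec i) (trans (sym (lam-prev≡rho i)) (trans lam-prev≡lam-j (sym i≡lam-j)))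

    ∈I∩I⇒≡lam : ∀ {i j z} → i ≢ j → z ∈ I i → z ∈ I j → z ≡ lam i ⊎ z ≡ lam j
    ∈I∩I⇒≡lam i≢j z∈Ii z∈Ij with ∈I⇒covers⊎≡lam z∈Ii | ∈I⇒covers⊎≡lam z∈Ij
    ... | inj₁ covers-i | inj₁ covers-j = ⊥-elim (i≢j (covered-once covers-i covers-j))
    ... | inj₂ z≡lam-i | _ = inj₁ z≡lam-i
    ... | inj₁ _ | inj₂ z≡lam-j = inj₂ z≡lam-j

    lam∈I⇒covers : ∀ {i j} → lam i ∈ I j → lam i ≢ lam j → Covers j (lam i)
    lam∈I⇒covers lam-i∈ lam-i≢lam-j = [ id , ⊥-elim ∘ lam-i≢lam-j ]′ (∈I⇒covers⊎≡lam lam-i∈)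

    lam∈I∧lam∈I-absurd : ∀ {i j} → lam i ∈ I j → lam j ∈ I i → lam i ≢ lam j → ⊥
    lam∈I∧lam∈I-absurd {i} {j} lam-i∈ lam-j∈ ≢ =
      MutuallyCovering.absurd i j (lam∈I⇒covers lam-i∈ ≢) (lam∈I⇒covers lam-j∈ (≢ ∘ sym)) ≢

    ∣I∩I∣≤1 : ∀ i j → i ≢ j → ∣ I i ∩ I j ∣ ≤ 1
    ∣I∩I∣≤1 i j i≢j with ∣ I i ∩ I j ∣ ≤? 1
    ... | yes ≤1 = ≤1
    ... | no ≰1 with 0<∣p∣⇒Nonempty {p = I i ∩ I j} (≤-trans (s≤s z≤n) (≰⇒> ≰1))
    ...   | x , x∈ with 2≤∣p∣⇒∃-other (≰⇒> ≰1) x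
    ...     | y , y∈ , y≢x with x∈p∩q⁻ (I i) (I j) x∈ | x∈p∩q⁻ (I i) (I j) y∈
    ...       | x∈Ii , x∈Ij | y∈Ii , y∈Ij
                with ∈I∩I⇒≡lam i≢j x∈Ii x∈Ij | ∈I∩I⇒≡lam i≢j y∈Ii y∈Ij
    ...         | inj₁ refl | inj₁ refl = ⊥-elim (y≢x refl)
    ...         | inj₂ refl | inj₂ refl = ⊥-elim (y≢x refl)
    ...         | inj₁ refl | inj₂ refl = ⊥-elim (lam∈I∧lam∈I-absurd x∈Ij y∈Ii (y≢x ∘ sym))
    ...         | inj₂ refl | inj₁ refl = ⊥-elim (lam∈I∧lam∈I-absurd y∈Ij x∈Ii y≢x)

proposition3p5 : (r n : ℕ) → 2 ≤ r → 2 * r ≤ n →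
  (H : Hypergraph n) → Decidable H → (∀ h → H h → ∣ h ∣ ≡ r) →
  Saturated r H →
  -- λ and ρ are well defined (existence; uniqueness is immediate)
  ((i : Fin n) → ∃ λ j → IsLambda H i j) ×
  ((i : Fin n) → ∃ λ j → IsRho H i j) ×
  -- for the functions λ = lam and ρ = rho:
  ((lam rho : Fin n → Fin n) →
    ((i : Fin n) → IsLambda H i (lam i)) →
    ((i : Fin n) → IsRho H i (rho i)) →
    -- (1)
    ((i : Fin n) → rho (next i) ≡ lam i) ×
    -- (2)
    ((i j : Fin n) → i ≢ j → ∣ cc (rho i) (lam i) ∩ cc (rho j) (lam j) ∣ ≤ 1) ×
    -- (3)
    ((j : Fin n) → ∃ λ i →
      (j ∈ cc (rho i) (lam i) × next j ∈ cc (rho i) (lam i)) ×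
      ((i′ : Fin n) → j ∈ cc (rho i′) (lam i′) → next j ∈ cc (rho i′) (lam i′) →
        cc (rho i′) (lam i′) ≡ cc (rho i) (lam i))) ×
    -- (4)
    ((i : Fin n) → lam i ≢ rho i →
      (lam (rho i) ≡ i) × (rho (rho i) ∈ co (lam i) i)))
proposition3p5 r zero 2≤r 2r≤0 with ≤-trans 2≤r (≤-trans (m≤n*m r 2) 2r≤0)
... | ()
proposition3p5 r (suc m) 2≤r 2r≤N H H? uniform saturated =
  ∃-lam , ∃-rho , λ lam rho lam-spec rho-spec → let open Intervals lam rho lam-spec rho-spec in
    rho∘next≡lam , ∣I∩I∣≤1 , consecutive-in-unique-interval , λ i lam≢rho → lam-rho i lam≢rho , rho∘rho∈ i
  where
  open SaturatedHypergraph m (≤-trans 2≤r (≤-trans (m≤n*m r 2) 2r≤N)) r 2≤r 2r≤N H H? uniform saturated
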